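{- Let $\lambda,\mu$ be partitions with at most $n$ parts, $\mu\subseteq\lambda$, let $r,s\in\mathbb Z_{\ge0}^n$, and let $1\le k\le n-1$ satisfy $\mu_k\ge\lambda_{k+1}$. For a sequence $t=(t_1,\dots,t_n)$ write $t^{(1)}=(t_1,\dots,t_k)$ and $t^{(2)}=(t_{k+1},\dots,t_n)$. Let $\phi_\beta$ be the substitution $\beta_i\mapsto\beta_{i+1}$ for all $i\ge1$. Then \[ G^{\mathrm{row}(r,s)}_{\lambda/\mu}(x;\alpha,\beta)=G^{\mathrm{row}(r^{(1)},s^{(1)})}_{\lambda^{(1)}/\mu^{(1)}}(x;\alpha,\beta)\cdot\phi_\beta^k\Big(G^{\mathrm{row}(r^{(2)},s^{(2)})}_{\lambda^{(2)}/\mu^{(2)}}(x;\alpha,\beta)\Big), \] and the same identity holds with every $G$ replaced by $\widetilde G$.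
   Context: Indeterminates $x=(x_1,x_2,\dots)$, $\alpha=(\alpha_i)$, $\beta=(\beta_i)$. $A_m=\alpha_1+\dots+\alpha_m$, $B_m=\beta_1+\dots+\beta_m$ ($=0$ for $m\le0$); $X_{[r,s]}=x_r+\dots+x_s$ ($=0$ if $r>s$). For a formal $\mathbb Z$-linear combination $Z=\sum_vc_vv$ of finitely many indeterminates, $h_m[Z]$ is the coefficient of $t^m$ in $\prod_v(1-vt)^{ -c_v}$; $h_m[Y\ominus Z]=\sum_{b\ge0}h_{m+b}[Y]h_b[Z]$. For partitions $\lambda,\mu$ with at most $n$ parts (padded with zeros) and $r,s\in\mathbb Z_{\ge0}^n$, \[ \widetilde G^{\mathrm{row}(r,s)}_{\lambda/\mu}(x;\alpha,\beta)=\prod_{i=1}^n\prod_{l=r_i}^{s_i}(1-\beta_ix_l)\cdot\det\Big(h_{\lambda_i-\mu_j-i+j}\big[X_{[r_j,s_i]}\ominus(A_{\lambda_i}-A_{\mu_j}-B_{i-1}+B_j)\big]\Big)_{i,j=1}^n \] (empty products equal $1$). A marked multiset-valued tableau of skew shape $\lambda/\mu$ (cells $(i,j)$ with $\mu_i<j\le\lambda_i$) is a filling $T$ with nonempty finite multisets $\{a_1\le\dots\le a_k\}$ of positive integers, where each $a_t$ with $t\ge2$, $a_{t-1}<a_t$ may be marked, such that $\max T(i,j)\le\min T(i,j+1)$ and $\max T(i,j)<\min T(i+1,j)$ whenever both cells are in the shape; $\mathrm{wt}(T)=\prod x^{T(i,j)}\alpha_j^{u(i,j)-1}(-\beta_i)^{m(i,j)}$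 with $x^{T(i,j)}=\prod_kx_k^{(\#k\text{ in }T(i,j))}$, $u,m$ the numbers of unmarked/marked elements. $G^{\mathrm{row}(r,s)}_{\lambda/\mu}(x;\alpha,\beta)$ is the sum of $\mathrm{wt}(T)$ over such $T$ with $r_i\le\min T(i,j)$, $\max T(i,j)\le s_i$ for all cells. -}

module Defs where

open import Data.Nat as ℕ using (ℕ; zero; suc; _≤_; _<_; _⊓_; _⊔_; _∸_; _≡ᵇ_; _≤ᵇ_; _<ᵇ_)
open import Data.Nat.Combinatorics using (_C_)
open import Data.Integer as ℤ using (ℤ; +_; -[1+_]; 0ℤ; 1ℤ)
open import Data.Bool using (Bool; true; false; if_then_else_; _∧_; not)
open import Data.List using (List; []; _∷_; [_]; map; concatMap; foldr; upTo; length; replicate; _++_; take; drop)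
open import Data.Product using (_×_; _,_; proj₁; proj₂)
open import Relation.Binary.PropositionalEquality using (_≡_)
open import Relation.Nullary using (does)

-- Formal power series in x = (x₁,x₂,…), α = (α₁,…), β = (β₁,…) with
-- integer coefficients, represented by their coefficient functions.
-- A monomial is a triple of exponent lists; position 0 of each list is
-- the exponent of the variable with index 1.  Lists are compared up to
-- trailing zeros.

Exps : Set
Exps = List ℕ

Mon : Set
Mon = Exps × Exps × Exps   -- (x-exponents , α-exponents , β-exponents)

Series : Set
Series = Mon → ℤ

_≋_ : Series → Series → Set
F ≋ G = ∀ m → F m ≡ G m

infix 4 _≋_

sumℤ : List ℤ → ℤ
sumℤ = foldr ℤ._+_ 0ℤ

prodℤ : List ℤ → ℤ
prodℤ = foldr ℤ._*_ 1ℤ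

sumℕ : List ℕ → ℕ
sumℕ = foldr ℕ._+_ 0

eqExps : Exps → Exps → Bool
eqExps [] [] = true
eqExps [] (y ∷ ys) = (y ≡ᵇ 0) ∧ eqExps [] ys
eqExps (x ∷ xs) [] = (x ≡ᵇ 0) ∧ eqExps xs []
eqExps (x ∷ xs) (y ∷ ys) = (x ≡ᵇ y) ∧ eqExps xs ys

eqMon : Mon → Mon → Bool
eqMon (a , c , d) (a' , c' , d') = eqExps a a' ∧ (eqExps c c' ∧ eqExps d d')

addE : Exps → Exps → Exps
addE [] ys = ys
addE xs [] = xs
addE (x ∷ xs) (y ∷ ys) = (x ℕ.+ y) ∷ addE xs ys

subE : Exps → Exps → Exps
subE [] _ = []
subE xs [] = xs
subE (x ∷ xs) (y ∷ ys) = (x ∸ y) ∷ subE xs ys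

expOf : ℕ → ℕ → Exps
expOf i p = replicate (i ∸ 1) 0 ++ [ p ]

degMon : Mon → ℕ
degMon (a , c , d) = sumℕ a ℕ.+ sumℕ c ℕ.+ sumℕ d

zeroS : Series
zeroS _ = 0ℤ

monoS : Mon → Series
monoS m₀ m = if eqMon m₀ m then 1ℤ else 0ℤ

oneS : Series
oneS = monoS ([] , [] , [])

_⊕_ : Series → Series → Series
(F ⊕ G) m = F m ℤ.+ G m

negS : Series → Series
negS F m = ℤ.- (F m)

_⊖S_ : Series → Series → Series
F ⊖S G = F ⊕ negS G

infixl 6 _⊕_ _⊖S_
infixl 6 _⊞_
infixl 9 _!_
infixl 7 _⊛_

subs : Exps → List Exps
subs [] = [ [] ]
subs (e ∷ es) = concatMap (λ j → map (j ∷_) (subs es)) (upTo (suc e))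

_⊛_ : Series → Series → Series
(F ⊛ G) (a , c , d) =
  sumℤ (concatMap (λ a' → concatMap (λ c' → map (λ d' →
      F (a' , c' , d') ℤ.* G (subE a a' , subE c c' , subE d d'))
    (subs d)) (subs c)) (subs a))

prodS : List Series → Series
prodS = foldr _⊛_ oneS

sumS : List Series → Series
sumS = foldr _⊕_ zeroS

φβ : Series → Series
φβ F (a , c , []) = F (a , c , [])
φβ F (a , c , zero ∷ d) = F (a , c , d)
φβ F (a , c , suc _ ∷ d) = 0ℤ

iter : ℕ → (Series → Series) → Series → Series
iter zero f F = F
iter (suc k) f F = f (iter k f F)

LinComb : Set
LinComb = List ℤ × List ℤ × List ℤ  -- coefficients of (x's , α's , β's), index 1 at position 0

addZ : List ℤ → List ℤ → List ℤ
addZ [] ys = ys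
addZ xs [] = xs
addZ (x ∷ xs) (y ∷ ys) = (x ℤ.+ y) ∷ addZ xs ys

_⊞_ : LinComb → LinComb → LinComb
(a , b , c) ⊞ (a' , b' , c') = addZ a a' , addZ b b' , addZ c c'

negL : LinComb → LinComb
negL (a , b , c) = map ℤ.-_ a , map ℤ.-_ b , map ℤ.-_ c

getZ : List ℤ → ℕ → ℤ
getZ [] _ = 0ℤ
getZ (x ∷ xs) zero = x
getZ (x ∷ xs) (suc i) = getZ xs i

-- coefficient of (v t)^e in (1 - v t)^(-c)
binCoef : ℤ → ℕ → ℤ
binCoef (+ n) e = + ((n ℕ.+ e ∸ 1) C e)
binCoef -[1+ n ] e = ((ℤ.- 1ℤ) ℤ.^ e) ℤ.* + (suc n C e)

prodCoefs : List ℤ → ℕ → Exps → ℤ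
prodCoefs cs i [] = 1ℤ
prodCoefs cs i (e ∷ es) = binCoef (getZ cs i) e ℤ.* prodCoefs cs (suc i) es

-- h_m[Z] = coefficient of t^m in ∏_v (1 - v t)^(-c_v), as a series
hS : ℤ → LinComb → Series
hS m (zx , za , zb) (a , c , d) =
  if does ((+ degMon (a , c , d)) ℤ.≟ m)
  then prodCoefs zx 0 a ℤ.* (prodCoefs za 0 c ℤ.* prodCoefs zb 0 d)
  else 0ℤ

-- h_m[Y ⊖ Z] = Σ_{b ≥ 0} h_{m+b}[Y] h_b[Z].  At a monomial of total degree D
-- only the terms b ≤ D can contribute (h_b[Z] is homogeneous of degree b),
-- so the coefficient is the finite sum over b = 0..D.
hMinus : ℤ → LinComb → LinComb → Series
hMinus m Y Z mon =
  sumℤ (map (λ b → (hS (m ℤ.+ + b) Y ⊛ hS (+ b) Z) mon) (upTo (suc (degMon mon))))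

_!_ : List ℕ → ℕ → ℕ
xs ! zero = 0
[] ! suc i = 0
(x ∷ xs) ! suc zero = x
(x ∷ xs) ! suc (suc i) = xs ! suc i

-- X_{[r,s]} = x_r + … + x_s (variables x_l exist for l ≥ 1 only)
Xint : ℕ → ℕ → LinComb
Xint r s = map (λ l → if (r ≤ᵇ suc l) ∧ (suc l ≤ᵇ s) then 1ℤ else 0ℤ) (upTo s) , [] , []

ones : ℕ → List ℤ
ones m = replicate m 1ℤ

Aα : ℕ → LinComb
Aα m = [] , ones m , []

Bβ : ℕ → LinComb
Bβ m = [] , [] , ones m

-- Determinant (Laplace expansion along the first row), indices 0-based

skip : ℕ → ℕ → ℕ
skip j j' = if j' <ᵇ j then j' else suc j'

det : ℕ → (ℕ → ℕ → Series) → Series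
det zero M = oneS
det (suc n) M =
  sumS (map (λ j → (λ m → ((ℤ.- 1ℤ) ℤ.^ j) ℤ.* (M 0 j ⊛ det n (λ i' j' → M (suc i') (skip j j'))) m))
            (upTo (suc n)))

range : ℕ → ℕ → List ℕ
range a b = map (λ t → a ℕ.+ t) (upTo (suc b ∸ a))

Gt : List ℕ → List ℕ → List ℕ → List ℕ → Series
Gt la mu r s = prefactor ⊛ det n M
  where
  n = length la
  factor : ℕ → ℕ → Series
  factor i l = oneS ⊖S monoS (expOf l 1 , [] , expOf i 1)
  prefactor : Series
  prefactor = prodS (map (λ i → prodS (map (factor i)
                 (range (r ! i ⊔ 1) (s ! i)))) (range 1 n))
  M : ℕ → ℕ → Series
  M i0 j0 = hMinus (+ (la ! i) ℤ.- + (mu ! j) ℤ.- + i ℤ.+ + j)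
                   (Xint (r ! j) (s ! i))
                   (Aα (la ! i) ⊞ negL (Aα (mu ! j)) ⊞ negL (Bβ (i ∸ 1)) ⊞ Bβ j)
    where
    i = suc i0
    j = suc j0

-- A cell entry {a₁ ≤ … ≤ a_k}, listed in weakly increasing order, each
-- element paired with a flag "marked".
Entry : Set
Entry = List (ℕ × Bool)

chainOK : ℕ → Entry → Bool
chainOK v [] = true
chainOK v ((w , b) ∷ rest) = (v ≤ᵇ w) ∧ ((if b then v <ᵇ w else true) ∧ chainOK w rest)

validEntry : Entry → Bool
validEntry [] = false
validEntry ((v , b) ∷ rest) = not b ∧ ((1 ≤ᵇ v) ∧ chainOK v rest)

minE : Entry → ℕ
minE [] = 0
minE ((v , _) ∷ rest) = foldr _⊓_ v (map proj₁ rest)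

maxE : Entry → ℕ
maxE e = foldr _⊔_ 0 (map proj₁ e)

nMarked : Entry → ℕ
nMarked e = sumℕ (map (λ p → if proj₂ p then 1 else 0) e)

nUnmarked : Entry → ℕ
nUnmarked e = sumℕ (map (λ p → if proj₂ p then 0 else 1) e)

Cell : Set
Cell = ℕ × ℕ   -- (row i , column j), 1-indexed

cells : List ℕ → List ℕ → List Cell
cells la mu = concatMap (λ i → map (λ j → (i , j)) (range (suc (mu ! i)) (la ! i)))
                        (range 1 (length la))

Filling : Set
Filling = List (Cell × Entry)

eqCell : Cell → Cell → Bool
eqCell (i , j) (i' , j') = (i ≡ᵇ i') ∧ (j ≡ᵇ j')

allB : {A : Set} → (A → Bool) → List A → Bool
allB p = foldr (λ x acc → p x ∧ acc) true

pairOK : Filling → Cell × Entry → Bool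
pairOK T ((i , j) , e) = allB (λ q → check (proj₁ q) (proj₂ q)) T
  where
  check : Cell → Entry → Bool
  check c' e' =
    (if eqCell c' (i , suc j) then maxE e ≤ᵇ minE e' else true) ∧
    (if eqCell c' (suc i , j) then maxE e <ᵇ minE e' else true)

validTableau : List ℕ → List ℕ → Filling → Bool
validTableau r s T =
  allB (λ q → validEntry (proj₂ q)) T ∧
  (allB (pairOK T) T ∧
   allB (λ q → (r ! proj₁ (proj₁ q) ≤ᵇ minE (proj₂ q)) ∧ (maxE (proj₂ q) ≤ᵇ s ! proj₁ (proj₁ q))) T)

monCell : Cell × Entry → Mon
monCell ((i , j) , e) =
  foldr (λ p acc → addE (expOf (proj₁ p) 1) acc) [] e ,
  expOf j (nUnmarked e ∸ 1) ,
  expOf i (nMarked e)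

addMon : Mon → Mon → Mon
addMon (a , c , d) (a' , c' , d') = addE a a' , addE c c' , addE d d'

monT : Filling → Mon
monT T = foldr (λ q acc → addMon (monCell q) acc) ([] , [] , []) T

signT : Filling → ℤ
signT T = (ℤ.- 1ℤ) ℤ.^ sumℕ (map (λ q → nMarked (proj₂ q)) T)

alphabet : ℕ → List (ℕ × Bool)
alphabet N = concatMap (λ v → (suc v , false) ∷ (suc v , true) ∷ []) (upTo N)

listsLen : ℕ → ℕ → List Entry
listsLen N zero = [ [] ]
listsLen N (suc L) = concatMap (λ p → map (p ∷_) (listsLen N L)) (alphabet N)

entries : ℕ → ℕ → List Entry
entries N D = concatMap (listsLen N) (upTo (suc D))

fillings : ℕ → ℕ → List Cell → List Filling
fillings N D = foldr (λ c acc → concatMap (λ e → map ((c , e) ∷_) acc) (entries N D)) [ [] ]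

-- Every such T has
-- entries with values ≤ length a and of size ≤ Σ a, so it occurs exactly
-- once in the finite list  fillings (length a) (Σ a) (cells la mu).
G : List ℕ → List ℕ → List ℕ → List ℕ → Series
G la mu r s (a , c , d) =
  sumℤ (map (λ T → if validTableau r s T ∧ eqMon (monT T) (a , c , d) then signT T else 0ℤ)
            (fillings (length a) (sumℕ a) (cells la mu)))

-- partitions with at most n parts (padded with zeros), as lists of length n

IsPartition : List ℕ → Set
IsPartition xs = ∀ i → 1 ≤ i → xs ! suc i ≤ xs ! i

{-# OPTIONS --safe #-}
-- Both identities come from the block structure forced by μ_k ≥ λ_{k+1}.
--
-- In the determinant, the entries in rows > k and columns ≤ k vanish: there Z is minus a sum of
-- P variables, so h_b[Z] = 0 for b > P, while for b ≤ P the other factor h has negative index.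
-- Hence the determinant is the product of its two diagonal blocks. The lower block, like the lower
-- rows of the prefactor, is that of the lower shape with every β index raised by k, i.e. its image
-- under φβᵏ.
--
-- In the tableau sum, no cell of the rows > k lies directly below a cell of the rows ≤ k
-- (this is where μ_k ≥ λ_{k+1} is used), so a tableau of λ/μ is exactly a pair of tableaux of the
-- two parts. Weights multiply, and moving a filling down by k rows acts on its weight as φβᵏ.
-- Since a coefficient of G is computed by enumerating fillings with bounds depending on the
-- monomial, the product formula is first proved for fixed bounds and then compared coefficientwise.
module Submission where

open import Defs
open import Level using (0ℓ)
open import Algebra.Bundles using (CommutativeMonoid)
open import Algebra.Structures using (IsCommutativeMonoid)
import Algebra.Properties.CommutativeSemigroup as CommutativeSemigroupProperties
open import Data.Bool using (Bool; true; false; if_then_else_; _∧_; T)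
import Data.Bool.Properties as Boolₚ
open import Data.Integer as ℤ using (ℤ; -[1+_]; 0ℤ; 1ℤ; _+_; _*_; -_)
import Data.Integer.Properties as ℤₚ
open import Data.Integer.Tactic.RingSolver using (solve-∀)
open import Data.List using (List; []; _∷_; [_]; map; concat; concatMap; foldr; upTo; applyUpTo; length; replicate; _++_; take; drop)
import Data.List.Properties as Listₚ
open import Data.List.Relation.Unary.All as All using (All; []; _∷_)
import Data.List.Relation.Unary.All.Properties as Allₚ
open import Data.Nat as ℕ using (ℕ; zero; suc; _∸_; _≤_; _<_; z≤n; s≤s)
open import Data.Nat.Combinatorics using (k>n⇒nCk≡0)
import Data.Nat.Properties as ℕₚ
open import Data.Product using (_×_; _,_; proj₁; proj₂)
open import Data.Sum using (_⊎_; inj₁; inj₂)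
open import Function using (_∘_)
open import Relation.Binary.Bundles using (Setoid)
open import Relation.Binary.PropositionalEquality hiding ([_])
import Relation.Binary.Reasoning.Setoid as SetoidReasoning
open import Relation.Nullary using (Dec; yes; no; does; contradiction)
open import Relation.Nullary.Decidable using (decidable-stable)

open CommutativeSemigroupProperties ℕₚ.+-commutativeSemigroup using () renaming (interchange to +-interchangeℕ)
open CommutativeSemigroupProperties ℤₚ.+-commutativeSemigroup using () renaming (interchange to +-interchange)
open CommutativeSemigroupProperties ℤₚ.*-commutativeSemigroup using () renaming (interchange to *-interchange)
open CommutativeSemigroupProperties (CommutativeMonoid.commutativeSemigroup Boolₚ.∧-commutativeMonoid)
  using () renaming (interchange to ∧-interchange)

∑ : ∀ {A : Set} → (A → ℤ) → List A → ℤ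
∑ f xs = sumℤ (map f xs)

infix 5 ∑
syntax ∑ (λ x → e) xs = ∑[ x ← xs ] e

sumℤ-++ : ∀ xs ys → sumℤ (xs ++ ys) ≡ sumℤ xs + sumℤ ys
sumℤ-++ [] ys = sym (ℤₚ.+-identityˡ _)
sumℤ-++ (x ∷ xs) ys = trans (cong (x +_) (sumℤ-++ xs ys)) (sym (ℤₚ.+-assoc x _ _))

sumℤ-concatMap : ∀ {A : Set} (f : A → List ℤ) xs → sumℤ (concatMap f xs) ≡ ∑[ x ← xs ] sumℤ (f x)
sumℤ-concatMap f [] = refl
sumℤ-concatMap f (x ∷ xs) = trans (sumℤ-++ (f x) (concatMap f xs)) (cong (sumℤ (f x) +_) (sumℤ-concatMap f xs))

∑-++ : ∀ {A : Set} (f : A → ℤ) xs ys → ∑ f (xs ++ ys) ≡ ∑ f xs + ∑ f ys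
∑-++ f xs ys = trans (cong sumℤ (Listₚ.map-++ f xs ys)) (sumℤ-++ (map f xs) (map f ys))

∑-cong : {A : Set} {f g : A → ℤ} → (∀ x → f x ≡ g x) → ∀ xs → ∑ f xs ≡ ∑ g xs
∑-cong f≗g xs = cong sumℤ (Listₚ.map-cong f≗g xs)

∑-cong-local : {A : Set} {f g : A → ℤ} {xs : List A} → All (λ x → f x ≡ g x) xs → ∑ f xs ≡ ∑ g xs
∑-cong-local f≗g = cong sumℤ (Listₚ.map-cong-local f≗g)

∑-concatMap : ∀ {A B : Set} (g : B → ℤ) (f : A → List B) xs → ∑ g (concatMap f xs) ≡ ∑[ x ← xs ] ∑ g (f x)
∑-concatMap g f xs = trans (cong sumℤ (Listₚ.map-concatMap g f xs)) (sumℤ-concatMap (map g ∘ f) xs)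

∑-map : ∀ {A B : Set} (g : B → ℤ) (f : A → B) xs → ∑ g (map f xs) ≡ ∑ (g ∘ f) xs
∑-map g f xs = cong sumℤ (sym (Listₚ.map-∘ xs))

∑-singleton : ∀ {A : Set} (f : A → ℤ) x → ∑ f [ x ] ≡ f x
∑-singleton f x = ℤₚ.+-identityʳ (f x)

∑-+ : ∀ {A : Set} (f g : A → ℤ) xs → ∑[ x ← xs ] (f x + g x) ≡ ∑ f xs + ∑ g xs
∑-+ f g [] = refl
∑-+ f g (x ∷ xs) = trans (cong (f x + g x +_) (∑-+ f g xs)) (+-interchange (f x) (g x) _ _)

∑-*ˡ : ∀ {A : Set} c (f : A → ℤ) xs → ∑[ x ← xs ] (c * f x) ≡ c * ∑ f xs
∑-*ˡ c f [] = sym (ℤₚ.*-zeroʳ c)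
∑-*ˡ c f (x ∷ xs) = trans (cong (c * f x +_) (∑-*ˡ c f xs)) (sym (ℤₚ.*-distribˡ-+ c (f x) _))

∑-*ʳ : ∀ {A : Set} c (f : A → ℤ) xs → ∑[ x ← xs ] (f x * c) ≡ ∑ f xs * c
∑-*ʳ c f xs = trans (∑-cong (λ x → ℤₚ.*-comm (f x) c) xs) (trans (∑-*ˡ c f xs) (ℤₚ.*-comm c _))

∑-zero : {A : Set} {f : A → ℤ} → (∀ x → f x ≡ 0ℤ) → ∀ xs → ∑ f xs ≡ 0ℤ
∑-zero f≗0 [] = refl
∑-zero f≗0 (x ∷ xs) = cong₂ _+_ (f≗0 x) (∑-zero f≗0 xs)

∑-swap : ∀ {A B : Set} (f : A → B → ℤ) xs ys → ∑[ x ← xs ] ∑ (f x) ys ≡ ∑[ y ← ys ] ∑[ x ← xs ] f x y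
∑-swap f [] ys = sym (∑-zero (λ _ → refl) ys)
∑-swap f (x ∷ xs) ys = trans (cong (∑ (f x) ys +_) (∑-swap f xs ys)) (sym (∑-+ (f x) _ ys))

applyUpTo-+ : ∀ {A : Set} (f : ℕ → A) m n → applyUpTo f (m ℕ.+ n) ≡ applyUpTo f m ++ applyUpTo (f ∘ (m ℕ.+_)) n
applyUpTo-+ f zero n = refl
applyUpTo-+ f (suc m) n = cong (f 0 ∷_) (applyUpTo-+ (f ∘ suc) m n)

upTo-+ : ∀ m n → upTo (m ℕ.+ n) ≡ upTo m ++ map (m ℕ.+_) (upTo n)
upTo-+ m n = trans (applyUpTo-+ (λ i → i) m n) (cong (upTo m ++_) (sym (Listₚ.map-upTo (m ℕ.+_) n)))

upTo-split : ∀ {m n} → m ≤ n → upTo n ≡ upTo m ++ map (m ℕ.+_) (upTo (n ∸ m))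
upTo-split {m} m≤n = trans (cong upTo (sym (ℕₚ.m+[n∸m]≡n m≤n))) (upTo-+ m _)

All-upTo : ∀ {P : ℕ → Set} n → (∀ {j} → j < n → P j) → All P (upTo n)
All-upTo = Allₚ.applyUpTo⁺₁ (λ i → i)

∑-cong-upTo : ∀ {f g : ℕ → ℤ} n → (∀ {j} → j < n → f j ≡ g j) → ∑ f (upTo n) ≡ ∑ g (upTo n)
∑-cong-upTo n f≗g = ∑-cong-local (All-upTo n f≗g)

∑-upTo-suc : ∀ (f : ℕ → ℤ) n → ∑ f (upTo (suc n)) ≡ f 0 + ∑ (f ∘ suc) (upTo n)
∑-upTo-suc f n = cong (λ xs → f 0 + sumℤ xs) (trans (Listₚ.map-applyUpTo suc f n) (sym (Listₚ.map-upTo (f ∘ suc) n)))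

∑-upTo-∷ʳ : ∀ (f : ℕ → ℤ) n → ∑ f (upTo (suc n)) ≡ ∑ f (upTo n) + f n
∑-upTo-∷ʳ f n = begin
  ∑ f (upTo (suc n))        ≡⟨ cong (∑ f) (Listₚ.upTo-∷ʳ n) ⟨
  ∑ f (upTo n ++ [ n ])     ≡⟨ ∑-++ f (upTo n) [ n ] ⟩
  ∑ f (upTo n) + ∑ f [ n ]  ≡⟨ cong (∑ f (upTo n) +_) (∑-singleton f n) ⟩
  ∑ f (upTo n) + f n        ∎
  where open ≡-Reasoning

∑-upTo-reverse : ∀ e (f : ℕ → ℤ) → ∑ f (upTo (suc e)) ≡ ∑[ j ← upTo (suc e) ] f (e ∸ j)
∑-upTo-reverse zero f = refl
∑-upTo-reverse (suc e) f = begin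
  ∑ f (upTo (suc (suc e)))                              ≡⟨ ∑-upTo-suc f (suc e) ⟩
  f 0 + ∑ (f ∘ suc) (upTo (suc e))                      ≡⟨ cong (f 0 +_) (∑-upTo-reverse e (f ∘ suc)) ⟩
  f 0 + (∑[ j ← upTo (suc e) ] f (suc (e ∸ j)))           ≡⟨ cong (f 0 +_) (∑-cong-upTo (suc e) λ j<1+e →
                                                             cong f (sym (ℕₚ.+-∸-assoc 1 (ℕₚ.≤-pred j<1+e)))) ⟩
  f 0 + (∑[ j ← upTo (suc e) ] f (suc e ∸ j))             ≡⟨ ℤₚ.+-comm (f 0) _ ⟩
  (∑[ j ← upTo (suc e) ] f (suc e ∸ j)) + f 0             ≡⟨ cong (λ i → (∑[ j ← upTo (suc e) ] f (suc e ∸ j)) + f i) (ℕₚ.n∸n≡0 e) ⟨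
  (∑[ j ← upTo (suc e) ] f (suc e ∸ j)) + f (suc e ∸ suc e) ≡⟨ ∑-upTo-∷ʳ (λ j → f (suc e ∸ j)) (suc e) ⟨
  ∑[ j ← upTo (suc (suc e)) ] f (suc e ∸ j)             ∎
  where open ≡-Reasoning

-- Both sides sum h i l m over the triples with i + l + m = e.
∑-upTo-triangle : ∀ e (h : ℕ → ℕ → ℕ → ℤ) →
  ∑[ j ← upTo (suc e) ] ∑[ i ← upTo (suc j) ] h i (j ∸ i) (e ∸ j) ≡
  ∑[ i ← upTo (suc e) ] ∑[ l ← upTo (suc (e ∸ i)) ] h i l (e ∸ i ∸ l)
∑-upTo-triangle zero h = refl
∑-upTo-triangle (suc e) h = begin
  ∑[ j ← upTo (suc (suc e)) ] ∑[ i ← upTo (suc j) ] h i (j ∸ i) (suc e ∸ j)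
    ≡⟨ ∑-cong (λ j → ∑-upTo-suc (λ i → h i (j ∸ i) (suc e ∸ j)) j) (upTo (suc (suc e))) ⟩
  ∑[ j ← upTo (suc (suc e)) ] (h 0 j (suc e ∸ j) + (∑[ i ← upTo j ] h (suc i) (j ∸ suc i) (suc e ∸ j)))
    ≡⟨ ∑-+ (λ j → h 0 j (suc e ∸ j)) _ (upTo (suc (suc e))) ⟩
  terms₀ + (∑[ j ← upTo (suc (suc e)) ] ∑[ i ← upTo j ] h (suc i) (j ∸ suc i) (suc e ∸ j))
    ≡⟨ cong (terms₀ +_) (trans (∑-upTo-suc (λ j → ∑[ i ← upTo j ] h (suc i) (j ∸ suc i) (suc e ∸ j)) (suc e)) (ℤₚ.+-identityˡ _)) ⟩
  terms₀ + (∑[ j ← upTo (suc e) ] ∑[ i ← upTo (suc j) ] h (suc i) (j ∸ i) (e ∸ j))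
    ≡⟨ cong (terms₀ +_) (∑-upTo-triangle e (h ∘ suc)) ⟩
  terms₀ + (∑[ i ← upTo (suc e) ] ∑[ l ← upTo (suc (e ∸ i)) ] h (suc i) l (e ∸ i ∸ l))
    ≡⟨ ∑-upTo-suc (λ i → ∑[ l ← upTo (suc (suc e ∸ i)) ] h i l (suc e ∸ i ∸ l)) (suc e) ⟨
  ∑[ i ← upTo (suc (suc e)) ] ∑[ l ← upTo (suc (suc e ∸ i)) ] h i l (suc e ∸ i ∸ l) ∎
  where
  open ≡-Reasoning
  terms₀ = ∑[ l ← upTo (suc (suc e)) ] h 0 l (suc e ∸ l)

∑≤ : Exps → (Exps → ℤ) → ℤ
∑≤ a f = ∑ f (subs a)

infix 5 ∑≤
syntax ∑≤ a (λ x → e) = ∑[ x ≤ a ] e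

∑≤-∷ : ∀ e es (f : Exps → ℤ) → ∑≤ (e ∷ es) f ≡ ∑[ j ← upTo (suc e) ] ∑[ t ≤ es ] f (j ∷ t)
∑≤-∷ e es f = trans (∑-concatMap f (λ j → map (j ∷_) (subs es)) (upTo (suc e)))
                    (∑-cong (λ j → ∑-map f (j ∷_) (subs es)) (upTo (suc e)))

∑≤-cong : ∀ a {f g : Exps → ℤ} → (∀ x → f x ≡ g x) → ∑≤ a f ≡ ∑≤ a g
∑≤-cong a f≗g = ∑-cong f≗g (subs a)

∑≤-assoc : ∀ a (g : Exps → Exps → Exps → ℤ) →
  ∑[ x ≤ a ] ∑[ y ≤ x ] g y (subE x y) (subE a x) ≡ ∑[ y ≤ a ] ∑[ z ≤ subE a y ] g y z (subE (subE a y) z)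
∑≤-assoc [] g = refl
∑≤-assoc (e ∷ es) g = begin
  ∑[ x ≤ e ∷ es ] ∑[ y ≤ x ] g y (subE x y) (subE (e ∷ es) x)
    ≡⟨ ∑≤-∷ e es _ ⟩
  ∑[ j ← upTo (suc e) ] ∑[ t ≤ es ] ∑[ y ≤ j ∷ t ] g y (subE (j ∷ t) y) ((e ∸ j) ∷ subE es t)
    ≡⟨ ∑-cong (λ j → ∑≤-cong es (λ t → ∑≤-∷ j t _)) (upTo (suc e)) ⟩
  ∑[ j ← upTo (suc e) ] ∑[ t ≤ es ] ∑[ i ← upTo (suc j) ] ∑[ u ≤ t ] g (i ∷ u) ((j ∸ i) ∷ subE t u) ((e ∸ j) ∷ subE es t)
    ≡⟨ ∑-cong (λ j → ∑-swap _ (subs es) (upTo (suc j))) (upTo (suc e)) ⟩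
  ∑[ j ← upTo (suc e) ] ∑[ i ← upTo (suc j) ] ∑[ t ≤ es ] ∑[ u ≤ t ] g (i ∷ u) ((j ∸ i) ∷ subE t u) ((e ∸ j) ∷ subE es t)
    ≡⟨ ∑-cong (λ j → ∑-cong (λ i → ∑≤-assoc es (λ u v w → g (i ∷ u) ((j ∸ i) ∷ v) ((e ∸ j) ∷ w))) (upTo (suc j))) (upTo (suc e)) ⟩
  ∑[ j ← upTo (suc e) ] ∑[ i ← upTo (suc j) ] H i (j ∸ i) (e ∸ j)
    ≡⟨ ∑-upTo-triangle e H ⟩
  ∑[ i ← upTo (suc e) ] ∑[ l ← upTo (suc (e ∸ i)) ] H i l (e ∸ i ∸ l)
    ≡⟨ ∑-cong (λ i → ∑-swap _ (subs es) (upTo (suc (e ∸ i)))) (upTo (suc e)) ⟨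
  ∑[ i ← upTo (suc e) ] ∑[ u ≤ es ] ∑[ l ← upTo (suc (e ∸ i)) ] ∑[ v ≤ subE es u ] g (i ∷ u) (l ∷ v) ((e ∸ i ∸ l) ∷ subE (subE es u) v)
    ≡⟨ ∑-cong (λ i → ∑≤-cong es (λ u → ∑≤-∷ (e ∸ i) (subE es u) _)) (upTo (suc e)) ⟨
  ∑[ i ← upTo (suc e) ] ∑[ u ≤ es ] ∑[ z ≤ (e ∸ i) ∷ subE es u ] g (i ∷ u) z (subE ((e ∸ i) ∷ subE es u) z)
    ≡⟨ ∑≤-∷ e es _ ⟨
  ∑[ y ≤ e ∷ es ] ∑[ z ≤ subE (e ∷ es) y ] g y z (subE (subE (e ∷ es) y) z) ∎
  where
  open ≡-Reasoning
  H : ℕ → ℕ → ℕ → ℤ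
  H i l m = ∑[ u ≤ es ] ∑[ v ≤ subE es u ] g (i ∷ u) (l ∷ v) (m ∷ subE (subE es u) v)

∑≤-comm : ∀ a (g : Exps → Exps → ℤ) → ∑[ x ≤ a ] g x (subE a x) ≡ ∑[ x ≤ a ] g (subE a x) x
∑≤-comm [] g = refl
∑≤-comm (e ∷ es) g = begin
  ∑[ x ≤ e ∷ es ] g x (subE (e ∷ es) x)                              ≡⟨ ∑≤-∷ e es _ ⟩
  ∑[ j ← upTo (suc e) ] ∑[ t ≤ es ] g (j ∷ t) ((e ∸ j) ∷ subE es t)  ≡⟨ ∑-cong (λ j → ∑≤-comm es (λ u v → g (j ∷ u) ((e ∸ j) ∷ v))) (upTo (suc e)) ⟩
  ∑[ j ← upTo (suc e) ] ∑[ t ≤ es ] g (j ∷ subE es t) ((e ∸ j) ∷ t)  ≡⟨ ∑-upTo-reverse e (λ j → ∑[ t ≤ es ] g (j ∷ subE es t) ((e ∸ j) ∷ t)) ⟩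
  ∑[ j ← upTo (suc e) ] ∑[ t ≤ es ] g ((e ∸ j) ∷ subE es t) ((e ∸ (e ∸ j)) ∷ t)
    ≡⟨ ∑-cong-upTo (suc e) (λ {j} j<1+e → ∑≤-cong es (λ t →
         cong (λ i → g ((e ∸ j) ∷ subE es t) (i ∷ t)) (ℕₚ.m∸[m∸n]≡n (ℕₚ.≤-pred j<1+e)))) ⟩
  ∑[ j ← upTo (suc e) ] ∑[ t ≤ es ] g ((e ∸ j) ∷ subE es t) (j ∷ t)  ≡⟨ ∑≤-∷ e es _ ⟨
  ∑[ x ≤ e ∷ es ] g (subE (e ∷ es) x) x                              ∎
  where open ≡-Reasoning

𝟙 : Bool → ℤ
𝟙 b = if b then 1ℤ else 0ℤ

𝟙-∧ : ∀ b c → 𝟙 (b ∧ c) ≡ 𝟙 b * 𝟙 c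
𝟙-∧ true c = sym (ℤₚ.*-identityˡ (𝟙 c))
𝟙-∧ false c = refl

∑≤-unit : ∀ a (g : Exps → ℤ) → ∑[ x ≤ a ] 𝟙 (eqExps [] x) * g (subE a x) ≡ g a
∑≤-unit [] g = trans (ℤₚ.+-identityʳ _) (ℤₚ.*-identityˡ (g []))
∑≤-unit (e ∷ es) g = begin
  ∑[ x ≤ e ∷ es ] 𝟙 (eqExps [] x) * g (subE (e ∷ es) x)
    ≡⟨ ∑≤-∷ e es _ ⟩
  ∑[ j ← upTo (suc e) ] ∑[ t ≤ es ] 𝟙 (eqExps [] (j ∷ t)) * g ((e ∸ j) ∷ subE es t)
    ≡⟨ ∑-upTo-suc (λ j → ∑[ t ≤ es ] 𝟙 (eqExps [] (j ∷ t)) * g ((e ∸ j) ∷ subE es t)) e ⟩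
  (∑[ t ≤ es ] 𝟙 (eqExps [] t) * g (e ∷ subE es t)) + (∑[ j ← upTo e ] ∑[ t ≤ es ] 0ℤ)
    ≡⟨ cong₂ _+_ (∑≤-unit es (λ t → g (e ∷ t))) (∑-zero (λ _ → ∑-zero (λ _ → refl) (subs es)) (upTo e)) ⟩
  g (e ∷ es) + 0ℤ
    ≡⟨ ℤₚ.+-identityʳ _ ⟩
  g (e ∷ es) ∎
  where open ≡-Reasoning

∑-upTo-𝟙𝟙 : ∀ h h' e → ∑[ j ← upTo (suc e) ] 𝟙 (h ℕ.≡ᵇ j) * 𝟙 (h' ℕ.≡ᵇ (e ∸ j)) ≡ 𝟙 ((h ℕ.+ h') ℕ.≡ᵇ e)
∑-upTo-𝟙𝟙 zero h' e = begin
  ∑[ j ← upTo (suc e) ] 𝟙 (0 ℕ.≡ᵇ j) * 𝟙 (h' ℕ.≡ᵇ (e ∸ j))  ≡⟨ ∑-upTo-suc (λ j → 𝟙 (0 ℕ.≡ᵇ j) * 𝟙 (h' ℕ.≡ᵇ (e ∸ j))) e ⟩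
  1ℤ * 𝟙 (h' ℕ.≡ᵇ e) + (∑[ j ← upTo e ] 0ℤ)                ≡⟨ cong₂ _+_ (ℤₚ.*-identityˡ (𝟙 (h' ℕ.≡ᵇ e))) (∑-zero (λ _ → refl) (upTo e)) ⟩
  𝟙 (h' ℕ.≡ᵇ e) + 0ℤ                                        ≡⟨ ℤₚ.+-identityʳ _ ⟩
  𝟙 (h' ℕ.≡ᵇ e)                                             ∎
  where open ≡-Reasoning
∑-upTo-𝟙𝟙 (suc h) h' zero = refl
∑-upTo-𝟙𝟙 (suc h) h' (suc e) = trans (∑-upTo-suc (λ j → 𝟙 (suc h ℕ.≡ᵇ j) * 𝟙 (h' ℕ.≡ᵇ (suc e ∸ j))) (suc e))
                                     (trans (ℤₚ.+-identityˡ _) (∑-upTo-𝟙𝟙 h h' e))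

hd : Exps → ℕ
hd [] = 0
hd (x ∷ _) = x

tl : Exps → Exps
tl [] = []
tl (_ ∷ xs) = xs

eqExps-∷ʳ : ∀ p j t → eqExps p (j ∷ t) ≡ ((hd p ℕ.≡ᵇ j) ∧ eqExps (tl p) t)
eqExps-∷ʳ [] zero t = refl
eqExps-∷ʳ [] (suc j) t = refl
eqExps-∷ʳ (x ∷ p) j t = refl

addE-[] : ∀ p → addE p [] ≡ p
addE-[] [] = refl
addE-[] (x ∷ p) = refl

hd-addE : ∀ p q → hd (addE p q) ≡ hd p ℕ.+ hd q
hd-addE [] q = refl
hd-addE (x ∷ p) [] = sym (ℕₚ.+-identityʳ x)
hd-addE (x ∷ p) (y ∷ q) = refl

tl-addE : ∀ p q → tl (addE p q) ≡ addE (tl p) (tl q)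
tl-addE [] q = refl
tl-addE (x ∷ p) [] = sym (addE-[] p)
tl-addE (x ∷ p) (y ∷ q) = refl

eqExps-addE-[] : ∀ p q → eqExps (addE p q) [] ≡ (eqExps p [] ∧ eqExps q [])
eqExps-addE-[] [] q = refl
eqExps-addE-[] (x ∷ p) [] = sym (Boolₚ.∧-identityʳ _)
eqExps-addE-[] (zero ∷ p) (zero ∷ q) = eqExps-addE-[] p q
eqExps-addE-[] (zero ∷ p) (suc y ∷ q) = sym (Boolₚ.∧-zeroʳ _)
eqExps-addE-[] (suc x ∷ p) (y ∷ q) = refl

∑≤-𝟙𝟙 : ∀ a p q → ∑[ x ≤ a ] 𝟙 (eqExps p x) * 𝟙 (eqExps q (subE a x)) ≡ 𝟙 (eqExps (addE p q) a)
∑≤-𝟙𝟙 [] p q = begin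
  𝟙 (eqExps p []) * 𝟙 (eqExps q []) + 0ℤ  ≡⟨ ℤₚ.+-identityʳ _ ⟩
  𝟙 (eqExps p []) * 𝟙 (eqExps q [])       ≡⟨ 𝟙-∧ (eqExps p []) (eqExps q []) ⟨
  𝟙 (eqExps p [] ∧ eqExps q [])           ≡⟨ cong 𝟙 (eqExps-addE-[] p q) ⟨
  𝟙 (eqExps (addE p q) [])                ∎
  where open ≡-Reasoning
∑≤-𝟙𝟙 (e ∷ es) p q = begin
  ∑[ x ≤ e ∷ es ] 𝟙 (eqExps p x) * 𝟙 (eqExps q (subE (e ∷ es) x))
    ≡⟨ ∑≤-∷ e es _ ⟩
  ∑[ j ← upTo (suc e) ] ∑[ t ≤ es ] 𝟙 (eqExps p (j ∷ t)) * 𝟙 (eqExps q ((e ∸ j) ∷ subE es t))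
    ≡⟨ ∑-cong (λ j → ∑≤-cong es (split j)) (upTo (suc e)) ⟩
  ∑[ j ← upTo (suc e) ] ∑[ t ≤ es ] δ j * δ' t
    ≡⟨ ∑-cong (λ j → ∑-*ˡ (δ j) δ' (subs es)) (upTo (suc e)) ⟩
  ∑[ j ← upTo (suc e) ] δ j * (∑[ t ≤ es ] δ' t)
    ≡⟨ ∑-cong (λ j → cong (δ j *_) (∑≤-𝟙𝟙 es (tl p) (tl q))) (upTo (suc e)) ⟩
  ∑[ j ← upTo (suc e) ] δ j * 𝟙 (eqExps (addE (tl p) (tl q)) es)
    ≡⟨ ∑-*ʳ _ δ (upTo (suc e)) ⟩
  (∑[ j ← upTo (suc e) ] δ j) * 𝟙 (eqExps (addE (tl p) (tl q)) es)
    ≡⟨ cong (_* 𝟙 (eqExps (addE (tl p) (tl q)) es)) (∑-upTo-𝟙𝟙 (hd p) (hd q) e) ⟩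
  𝟙 ((hd p ℕ.+ hd q) ℕ.≡ᵇ e) * 𝟙 (eqExps (addE (tl p) (tl q)) es)
    ≡⟨ 𝟙-∧ ((hd p ℕ.+ hd q) ℕ.≡ᵇ e) (eqExps (addE (tl p) (tl q)) es) ⟨
  𝟙 (((hd p ℕ.+ hd q) ℕ.≡ᵇ e) ∧ eqExps (addE (tl p) (tl q)) es)
    ≡⟨ cong₂ (λ h t → 𝟙 ((h ℕ.≡ᵇ e) ∧ eqExps t es)) (hd-addE p q) (tl-addE p q) ⟨
  𝟙 ((hd (addE p q) ℕ.≡ᵇ e) ∧ eqExps (tl (addE p q)) es)
    ≡⟨ cong 𝟙 (eqExps-∷ʳ (addE p q) e es) ⟨
  𝟙 (eqExps (addE p q) (e ∷ es)) ∎
  where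
  open ≡-Reasoning
  δ : ℕ → ℤ
  δ j = 𝟙 (hd p ℕ.≡ᵇ j) * 𝟙 (hd q ℕ.≡ᵇ (e ∸ j))
  δ' : Exps → ℤ
  δ' t = 𝟙 (eqExps (tl p) t) * 𝟙 (eqExps (tl q) (subE es t))
  split : ∀ j t → 𝟙 (eqExps p (j ∷ t)) * 𝟙 (eqExps q ((e ∸ j) ∷ subE es t)) ≡ δ j * δ' t
  split j t = begin
    𝟙 (eqExps p (j ∷ t)) * 𝟙 (eqExps q ((e ∸ j) ∷ subE es t))
      ≡⟨ cong₂ (λ u v → 𝟙 u * 𝟙 v) (eqExps-∷ʳ p j t) (eqExps-∷ʳ q (e ∸ j) (subE es t)) ⟩
    𝟙 ((hd p ℕ.≡ᵇ j) ∧ eqExps (tl p) t) * 𝟙 ((hd q ℕ.≡ᵇ (e ∸ j)) ∧ eqExps (tl q) (subE es t))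
      ≡⟨ cong₂ _*_ (𝟙-∧ (hd p ℕ.≡ᵇ j) (eqExps (tl p) t)) (𝟙-∧ (hd q ℕ.≡ᵇ (e ∸ j)) (eqExps (tl q) (subE es t))) ⟩
    (𝟙 (hd p ℕ.≡ᵇ j) * 𝟙 (eqExps (tl p) t)) * (𝟙 (hd q ℕ.≡ᵇ (e ∸ j)) * 𝟙 (eqExps (tl q) (subE es t)))
      ≡⟨ *-interchange (𝟙 (hd p ℕ.≡ᵇ j)) (𝟙 (eqExps (tl p) t)) (𝟙 (hd q ℕ.≡ᵇ (e ∸ j))) (𝟙 (eqExps (tl q) (subE es t))) ⟩
    δ j * δ' t ∎

-- Cauchy products

_∸ᴹ_ : Mon → Mon → Mon
(a , c , d) ∸ᴹ (a' , c' , d') = subE a a' , subE c c' , subE d d'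

∑ᴹ : Mon → (Mon → ℤ) → ℤ
∑ᴹ (a , c , d) f = ∑[ a' ≤ a ] ∑[ c' ≤ c ] ∑[ d' ≤ d ] f (a' , c' , d')

infix 5 ∑ᴹ
syntax ∑ᴹ m (λ x → e) = ∑ᴹ[ x ≤ m ] e

⊛-coeff : ∀ F G m → (F ⊛ G) m ≡ ∑ᴹ[ x ≤ m ] F x * G (m ∸ᴹ x)
⊛-coeff F G (a , c , d) = trans (sumℤ-concatMap (λ a' → concatMap (terms a') (subs c)) (subs a))
                                (∑-cong (λ a' → sumℤ-concatMap (terms a') (subs c)) (subs a))
  where
  terms : Exps → Exps → List ℤ
  terms a' c' = map (λ d' → F (a' , c' , d') * G (subE a a' , subE c c' , subE d d')) (subs d)

∑ᴹ-cong : ∀ m {f g : Mon → ℤ} → (∀ x → f x ≡ g x) → ∑ᴹ m f ≡ ∑ᴹ m g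
∑ᴹ-cong (a , c , d) f≗g = ∑≤-cong a λ a' → ∑≤-cong c λ c' → ∑≤-cong d λ d' → f≗g (a' , c' , d')

∑ᴹ-*ˡ : ∀ m k (f : Mon → ℤ) → ∑ᴹ[ x ≤ m ] k * f x ≡ k * ∑ᴹ m f
∑ᴹ-*ˡ (a , c , d) k f =
  trans (∑≤-cong a λ a' → trans (∑≤-cong c λ c' → ∑-*ˡ k (λ d' → f (a' , c' , d')) (subs d))
                                (∑-*ˡ k (λ c' → ∑[ d' ≤ d ] f (a' , c' , d')) (subs c)))
        (∑-*ˡ k (λ a' → ∑[ c' ≤ c ] ∑[ d' ≤ d ] f (a' , c' , d')) (subs a))

∑ᴹ-*ʳ : ∀ m k (f : Mon → ℤ) → ∑ᴹ[ x ≤ m ] f x * k ≡ ∑ᴹ m f * k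
∑ᴹ-*ʳ m k f = trans (∑ᴹ-cong m (λ x → ℤₚ.*-comm (f x) k)) (trans (∑ᴹ-*ˡ m k f) (ℤₚ.*-comm k (∑ᴹ m f)))

∑ᴹ-+ : ∀ m (f g : Mon → ℤ) → ∑ᴹ[ x ≤ m ] (f x + g x) ≡ ∑ᴹ m f + ∑ᴹ m g
∑ᴹ-+ (a , c , d) f g =
  trans (∑≤-cong a λ a' → trans (∑≤-cong c λ c' → ∑-+ (λ d' → f (a' , c' , d')) (λ d' → g (a' , c' , d')) (subs d))
                                (∑-+ (λ c' → ∑[ d' ≤ d ] f (a' , c' , d')) (λ c' → ∑[ d' ≤ d ] g (a' , c' , d')) (subs c)))
        (∑-+ (λ a' → ∑[ c' ≤ c ] ∑[ d' ≤ d ] f (a' , c' , d')) (λ a' → ∑[ c' ≤ c ] ∑[ d' ≤ d ] g (a' , c' , d')) (subs a))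

∑ᴹ-zero : ∀ m {f : Mon → ℤ} → (∀ x → f x ≡ 0ℤ) → ∑ᴹ m f ≡ 0ℤ
∑ᴹ-zero (a , c , d) f≗0 =
  ∑-zero (λ a' → ∑-zero (λ c' → ∑-zero (λ d' → f≗0 (a' , c' , d')) (subs d)) (subs c)) (subs a)

∑≤³-interleave : ∀ (a c d : Exps) (a' c' d' : Exps → Exps) (h : Exps → Exps → Exps → Exps → Exps → Exps → ℤ) →
  ∑[ x ≤ a ] ∑[ y ≤ c ] ∑[ z ≤ d ] ∑[ x' ≤ a' x ] ∑[ y' ≤ c' y ] ∑[ z' ≤ d' z ] h x y z x' y' z' ≡
  ∑[ x ≤ a ] ∑[ x' ≤ a' x ] ∑[ y ≤ c ] ∑[ y' ≤ c' y ] ∑[ z ≤ d ] ∑[ z' ≤ d' z ] h x y z x' y' z'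
∑≤³-interleave a c d a' c' d' h = ∑≤-cong a λ x → trans
  (∑≤-cong c λ y → ∑-swap (λ z x' → ∑[ y' ≤ c' y ] ∑[ z' ≤ d' z ] h x y z x' y' z') (subs d) (subs (a' x)))
  (trans (∑-swap (λ y x' → ∑[ z ≤ d ] ∑[ y' ≤ c' y ] ∑[ z' ≤ d' z ] h x y z x' y' z') (subs c) (subs (a' x)))
         (∑≤-cong (a' x) λ x' → ∑≤-cong c λ y → ∑-swap (λ z y' → ∑[ z' ≤ d' z ] h x y z x' y' z') (subs d) (subs (c' y))))

∑ᴹ-assoc : ∀ m (g : Mon → Mon → Mon → ℤ) →
  ∑ᴹ[ x ≤ m ] ∑ᴹ[ y ≤ x ] g y (x ∸ᴹ y) (m ∸ᴹ x) ≡ ∑ᴹ[ y ≤ m ] ∑ᴹ[ z ≤ m ∸ᴹ y ] g y z ((m ∸ᴹ y) ∸ᴹ z)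
∑ᴹ-assoc (a , c , d) g = begin
  ∑ᴹ[ x ≤ (a , c , d) ] ∑ᴹ[ y ≤ x ] g y (x ∸ᴹ y) ((a , c , d) ∸ᴹ x)
    ≡⟨ ∑≤³-interleave a c d (λ x → x) (λ x → x) (λ x → x)
         (λ a₁ c₁ d₁ a₂ c₂ d₂ → g (a₂ , c₂ , d₂) (subE a₁ a₂ , subE c₁ c₂ , subE d₁ d₂) (subE a a₁ , subE c c₁ , subE d d₁)) ⟩
  ∑[ a₁ ≤ a ] ∑[ a₂ ≤ a₁ ] ∑[ c₁ ≤ c ] ∑[ c₂ ≤ c₁ ] ∑[ d₁ ≤ d ] ∑[ d₂ ≤ d₁ ]
    g (a₂ , c₂ , d₂) (subE a₁ a₂ , subE c₁ c₂ , subE d₁ d₂) (subE a a₁ , subE c c₁ , subE d d₁)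
    ≡⟨ (∑≤-cong a λ a₁ → ∑≤-cong a₁ λ a₂ → ∑≤-cong c λ c₁ → ∑≤-cong c₁ λ c₂ →
         ∑≤-assoc d (λ d₂ d₃ d₄ → g (a₂ , c₂ , d₂) (subE a₁ a₂ , subE c₁ c₂ , d₃) (subE a a₁ , subE c c₁ , d₄))) ⟩
  ∑[ a₁ ≤ a ] ∑[ a₂ ≤ a₁ ] ∑[ c₁ ≤ c ] ∑[ c₂ ≤ c₁ ] ∑[ d₂ ≤ d ] ∑[ d₃ ≤ subE d d₂ ]
    g (a₂ , c₂ , d₂) (subE a₁ a₂ , subE c₁ c₂ , d₃) (subE a a₁ , subE c c₁ , subE (subE d d₂) d₃)
    ≡⟨ (∑≤-cong a λ a₁ → ∑≤-cong a₁ λ a₂ → ∑≤-assoc c (λ c₂ c₃ c₄ → ∑[ d₂ ≤ d ] ∑[ d₃ ≤ subE d d₂ ]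
         g (a₂ , c₂ , d₂) (subE a₁ a₂ , c₃ , d₃) (subE a a₁ , c₄ , subE (subE d d₂) d₃))) ⟩
  ∑[ a₁ ≤ a ] ∑[ a₂ ≤ a₁ ] ∑[ c₂ ≤ c ] ∑[ c₃ ≤ subE c c₂ ] ∑[ d₂ ≤ d ] ∑[ d₃ ≤ subE d d₂ ]
    g (a₂ , c₂ , d₂) (subE a₁ a₂ , c₃ , d₃) (subE a a₁ , subE (subE c c₂) c₃ , subE (subE d d₂) d₃)
    ≡⟨ ∑≤-assoc a (λ a₂ a₃ a₄ → ∑[ c₂ ≤ c ] ∑[ c₃ ≤ subE c c₂ ] ∑[ d₂ ≤ d ] ∑[ d₃ ≤ subE d d₂ ]
         g (a₂ , c₂ , d₂) (a₃ , c₃ , d₃) (a₄ , subE (subE c c₂) c₃ , subE (subE d d₂) d₃)) ⟩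
  ∑[ a₂ ≤ a ] ∑[ a₃ ≤ subE a a₂ ] ∑[ c₂ ≤ c ] ∑[ c₃ ≤ subE c c₂ ] ∑[ d₂ ≤ d ] ∑[ d₃ ≤ subE d d₂ ]
    g (a₂ , c₂ , d₂) (a₃ , c₃ , d₃) (subE (subE a a₂) a₃ , subE (subE c c₂) c₃ , subE (subE d d₂) d₃)
    ≡⟨ ∑≤³-interleave a c d (subE a) (subE c) (subE d)
         (λ a₂ c₂ d₂ a₃ c₃ d₃ → g (a₂ , c₂ , d₂) (a₃ , c₃ , d₃) (subE (subE a a₂) a₃ , subE (subE c c₂) c₃ , subE (subE d d₂) d₃)) ⟨
  ∑ᴹ[ y ≤ (a , c , d) ] ∑ᴹ[ z ≤ (a , c , d) ∸ᴹ y ] g y z (((a , c , d) ∸ᴹ y) ∸ᴹ z) ∎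
  where open ≡-Reasoning

∑ᴹ-comm : ∀ m (g : Mon → Mon → ℤ) → ∑ᴹ[ x ≤ m ] g x (m ∸ᴹ x) ≡ ∑ᴹ[ x ≤ m ] g (m ∸ᴹ x) x
∑ᴹ-comm (a , c , d) g =
  trans (∑≤-comm a (λ a₁ a₂ → ∑[ c' ≤ c ] ∑[ d' ≤ d ] g (a₁ , c' , d') (a₂ , subE c c' , subE d d')))
  (∑≤-cong a λ a' → trans (∑≤-comm c (λ c₁ c₂ → ∑[ d' ≤ d ] g (subE a a' , c₁ , d') (a' , c₂ , subE d d')))
  (∑≤-cong c λ c' → ∑≤-comm d (λ d₁ d₂ → g (subE a a' , subE c c' , d₁) (a' , c' , d₂))))

∑ᴹ-unit : ∀ m (g : Mon → ℤ) → ∑ᴹ[ x ≤ m ] 𝟙 (eqMon ([] , [] , []) x) * g (m ∸ᴹ x) ≡ g m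
∑ᴹ-unit (a , c , d) g = begin
  ∑[ a' ≤ a ] ∑[ c' ≤ c ] ∑[ d' ≤ d ] 𝟙 (eqExps [] a' ∧ (eqExps [] c' ∧ eqExps [] d')) * g (subE a a' , subE c c' , subE d d')
    ≡⟨ (∑≤-cong a λ a' → ∑≤-cong c λ c' → ∑≤-cong d λ d' → split a' c' d') ⟩
  ∑[ a' ≤ a ] ∑[ c' ≤ c ] ∑[ d' ≤ d ] 𝟙 (eqExps [] a') * (𝟙 (eqExps [] c') * (𝟙 (eqExps [] d') * g (subE a a' , subE c c' , subE d d')))
    ≡⟨ (∑≤-cong a λ a' → trans (∑≤-cong c λ c' → ∑-*ˡ (𝟙 (eqExps [] a')) _ (subs d)) (∑-*ˡ (𝟙 (eqExps [] a')) _ (subs c))) ⟩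
  ∑[ a' ≤ a ] 𝟙 (eqExps [] a') * (∑[ c' ≤ c ] ∑[ d' ≤ d ] 𝟙 (eqExps [] c') * (𝟙 (eqExps [] d') * g (subE a a' , subE c c' , subE d d')))
    ≡⟨ ∑≤-unit a (λ a' → ∑[ c' ≤ c ] ∑[ d' ≤ d ] 𝟙 (eqExps [] c') * (𝟙 (eqExps [] d') * g (a' , subE c c' , subE d d'))) ⟩
  ∑[ c' ≤ c ] ∑[ d' ≤ d ] 𝟙 (eqExps [] c') * (𝟙 (eqExps [] d') * g (a , subE c c' , subE d d'))
    ≡⟨ (∑≤-cong c λ c' → ∑-*ˡ (𝟙 (eqExps [] c')) _ (subs d)) ⟩
  ∑[ c' ≤ c ] 𝟙 (eqExps [] c') * (∑[ d' ≤ d ] 𝟙 (eqExps [] d') * g (a , subE c c' , subE d d'))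
    ≡⟨ ∑≤-unit c (λ c' → ∑[ d' ≤ d ] 𝟙 (eqExps [] d') * g (a , c' , subE d d')) ⟩
  ∑[ d' ≤ d ] 𝟙 (eqExps [] d') * g (a , c , subE d d')
    ≡⟨ ∑≤-unit d (λ d' → g (a , c , d')) ⟩
  g (a , c , d) ∎
  where
  open ≡-Reasoning
  split : ∀ a' c' d' → 𝟙 (eqExps [] a' ∧ (eqExps [] c' ∧ eqExps [] d')) * g (subE a a' , subE c c' , subE d d') ≡
                       𝟙 (eqExps [] a') * (𝟙 (eqExps [] c') * (𝟙 (eqExps [] d') * g (subE a a' , subE c c' , subE d d')))
  split a' c' d' = begin
    𝟙 (eqExps [] a' ∧ (eqExps [] c' ∧ eqExps [] d')) * rest
      ≡⟨ cong (_* rest) (trans (𝟙-∧ (eqExps [] a') _) (cong (𝟙 (eqExps [] a') *_) (𝟙-∧ (eqExps [] c') (eqExps [] d')))) ⟩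
    (𝟙 (eqExps [] a') * (𝟙 (eqExps [] c') * 𝟙 (eqExps [] d'))) * rest
      ≡⟨ ℤₚ.*-assoc (𝟙 (eqExps [] a')) _ rest ⟩
    𝟙 (eqExps [] a') * ((𝟙 (eqExps [] c') * 𝟙 (eqExps [] d')) * rest)
      ≡⟨ cong (𝟙 (eqExps [] a') *_) (ℤₚ.*-assoc (𝟙 (eqExps [] c')) (𝟙 (eqExps [] d')) rest) ⟩
    𝟙 (eqExps [] a') * (𝟙 (eqExps [] c') * (𝟙 (eqExps [] d') * rest)) ∎
    where
    rest = g (subE a a' , subE c c' , subE d d')


𝟙-∧³ : ∀ b c d → 𝟙 (b ∧ (c ∧ d)) ≡ 𝟙 b * (𝟙 c * 𝟙 d)
𝟙-∧³ b c d = trans (𝟙-∧ b (c ∧ d)) (cong (𝟙 b *_) (𝟙-∧ c d))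

∑ᴹ-𝟙𝟙 : ∀ m p q → ∑ᴹ[ x ≤ m ] 𝟙 (eqMon p x) * 𝟙 (eqMon q (m ∸ᴹ x)) ≡ 𝟙 (eqMon (addMon p q) m)
∑ᴹ-𝟙𝟙 (a , c , d) (pa , pc , pd) (qa , qc , qd) = begin
  ∑[ a' ≤ a ] ∑[ c' ≤ c ] ∑[ d' ≤ d ] 𝟙 (eqMon (pa , pc , pd) (a' , c' , d')) * 𝟙 (eqMon (qa , qc , qd) (subE a a' , subE c c' , subE d d'))
    ≡⟨ (∑≤-cong a λ a' → ∑≤-cong c λ c' → ∑≤-cong d λ d' → split a' c' d') ⟩
  ∑[ a' ≤ a ] ∑[ c' ≤ c ] ∑[ d' ≤ d ] δa a' * (δc c' * δd d')
    ≡⟨ (∑≤-cong a λ a' → trans (∑≤-cong c λ c' → ∑-*ˡ (δa a') (λ d' → δc c' * δd d') (subs d))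
                               (∑-*ˡ (δa a') (λ c' → ∑[ d' ≤ d ] δc c' * δd d') (subs c))) ⟩
  ∑[ a' ≤ a ] δa a' * (∑[ c' ≤ c ] ∑[ d' ≤ d ] δc c' * δd d')
    ≡⟨ ∑-*ʳ _ δa (subs a) ⟩
  (∑≤ a δa) * (∑[ c' ≤ c ] ∑[ d' ≤ d ] δc c' * δd d')
    ≡⟨ cong (∑≤ a δa *_) (trans (∑≤-cong c λ c' → ∑-*ˡ (δc c') δd (subs d)) (∑-*ʳ _ δc (subs c))) ⟩
  ∑≤ a δa * (∑≤ c δc * ∑≤ d δd)
    ≡⟨ cong₂ _*_ (∑≤-𝟙𝟙 a pa qa) (cong₂ _*_ (∑≤-𝟙𝟙 c pc qc) (∑≤-𝟙𝟙 d pd qd)) ⟩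
  𝟙 (eqExps (addE pa qa) a) * (𝟙 (eqExps (addE pc qc) c) * 𝟙 (eqExps (addE pd qd) d))
    ≡⟨ 𝟙-∧³ (eqExps (addE pa qa) a) (eqExps (addE pc qc) c) (eqExps (addE pd qd) d) ⟨
  𝟙 (eqMon (addMon (pa , pc , pd) (qa , qc , qd)) (a , c , d)) ∎
  where
  open ≡-Reasoning
  δa = λ a' → 𝟙 (eqExps pa a') * 𝟙 (eqExps qa (subE a a'))
  δc = λ c' → 𝟙 (eqExps pc c') * 𝟙 (eqExps qc (subE c c'))
  δd = λ d' → 𝟙 (eqExps pd d') * 𝟙 (eqExps qd (subE d d'))
  split : ∀ a' c' d' → 𝟙 (eqMon (pa , pc , pd) (a' , c' , d')) * 𝟙 (eqMon (qa , qc , qd) (subE a a' , subE c c' , subE d d'))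
                       ≡ δa a' * (δc c' * δd d')
  split a' c' d' = begin
    𝟙 (eqMon (pa , pc , pd) (a' , c' , d')) * 𝟙 (eqMon (qa , qc , qd) (subE a a' , subE c c' , subE d d'))
      ≡⟨ cong₂ _*_ (𝟙-∧³ (eqExps pa a') (eqExps pc c') (eqExps pd d')) (𝟙-∧³ (eqExps qa (subE a a')) (eqExps qc (subE c c')) (eqExps qd (subE d d'))) ⟩
    (𝟙 (eqExps pa a') * (𝟙 (eqExps pc c') * 𝟙 (eqExps pd d'))) * (𝟙 (eqExps qa (subE a a')) * (𝟙 (eqExps qc (subE c c')) * 𝟙 (eqExps qd (subE d d'))))
      ≡⟨ *-interchange (𝟙 (eqExps pa a')) _ (𝟙 (eqExps qa (subE a a'))) _ ⟩
    δa a' * ((𝟙 (eqExps pc c') * 𝟙 (eqExps pd d')) * (𝟙 (eqExps qc (subE c c')) * 𝟙 (eqExps qd (subE d d'))))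
      ≡⟨ cong (δa a' *_) (*-interchange (𝟙 (eqExps pc c')) (𝟙 (eqExps pd d')) (𝟙 (eqExps qc (subE c c'))) (𝟙 (eqExps qd (subE d d')))) ⟩
    δa a' * (δc c' * δd d') ∎

-- A record, unlike _≋_, lets Agda infer both series from a proof of their equality.
infix 4 _≈_
record _≈_ (F G : Series) : Set where
  constructor coeffwise
  field coeff : F ≋ G
open _≈_

≈-refl : ∀ {F} → F ≈ F
≈-refl = coeffwise λ _ → refl

≈-sym : ∀ {F G} → F ≈ G → G ≈ F
≈-sym F≈G = coeffwise λ m → sym (coeff F≈G m)

≈-trans : ∀ {F G H} → F ≈ G → G ≈ H → F ≈ H
≈-trans F≈G G≈H = coeffwise λ m → trans (coeff F≈G m) (coeff G≈H m)

≈-setoid : Setoid 0ℓ 0ℓ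
≈-setoid = record { Carrier = Series ; _≈_ = _≈_ ; isEquivalence = record { refl = ≈-refl ; sym = ≈-sym ; trans = ≈-trans } }

module ≈-Reasoning = SetoidReasoning ≈-setoid

infixr 8 _·_
_·_ : ℤ → Series → Series
(k · F) m = k * F m

⊕-cong : ∀ {F F' G G'} → F ≈ F' → G ≈ G' → F ⊕ G ≈ F' ⊕ G'
⊕-cong F≈F' G≈G' = coeffwise λ m → cong₂ _+_ (coeff F≈F' m) (coeff G≈G' m)

⊖S-cong : ∀ {F F' G G'} → F ≈ F' → G ≈ G' → F ⊖S G ≈ F' ⊖S G'
⊖S-cong F≈F' G≈G' = coeffwise λ m → cong₂ (λ u v → u + - v) (coeff F≈F' m) (coeff G≈G' m)

·-cong : ∀ k {F F'} → F ≈ F' → k · F ≈ k · F'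
·-cong k F≈F' = coeffwise λ m → cong (k *_) (coeff F≈F' m)

·-assoc : ∀ a b F → a · (b · F) ≈ (a * b) · F
·-assoc a b F = coeffwise λ m → sym (ℤₚ.*-assoc a b (F m))

⊛-cong : ∀ {F F' G G'} → F ≈ F' → G ≈ G' → F ⊛ G ≈ F' ⊛ G'
⊛-cong {F} {F'} {G} {G'} F≈F' G≈G' = coeffwise λ m → begin
  (F ⊛ G) m                         ≡⟨ ⊛-coeff F G m ⟩
  ∑ᴹ[ x ≤ m ] F x * G (m ∸ᴹ x)      ≡⟨ ∑ᴹ-cong m (λ x → cong₂ _*_ (coeff F≈F' x) (coeff G≈G' (m ∸ᴹ x))) ⟩
  ∑ᴹ[ x ≤ m ] F' x * G' (m ∸ᴹ x)    ≡⟨ ⊛-coeff F' G' m ⟨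
  (F' ⊛ G') m                       ∎
  where open ≡-Reasoning

⊛-congˡ : ∀ F {G G'} → G ≈ G' → F ⊛ G ≈ F ⊛ G'
⊛-congˡ F = ⊛-cong (≈-refl {F})

⊛-congʳ : ∀ G {F F'} → F ≈ F' → F ⊛ G ≈ F' ⊛ G
⊛-congʳ G F≈F' = ⊛-cong F≈F' (≈-refl {G})

⊛-comm : ∀ F G → F ⊛ G ≈ G ⊛ F
⊛-comm F G = coeffwise λ m → begin
  (F ⊛ G) m                         ≡⟨ ⊛-coeff F G m ⟩
  ∑ᴹ[ x ≤ m ] F x * G (m ∸ᴹ x)      ≡⟨ ∑ᴹ-comm m (λ x y → F x * G y) ⟩
  ∑ᴹ[ x ≤ m ] F (m ∸ᴹ x) * G x      ≡⟨ ∑ᴹ-cong m (λ x → ℤₚ.*-comm (F (m ∸ᴹ x)) (G x)) ⟩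
  ∑ᴹ[ x ≤ m ] G x * F (m ∸ᴹ x)      ≡⟨ ⊛-coeff G F m ⟨
  (G ⊛ F) m                         ∎
  where open ≡-Reasoning

⊛-identityˡ : ∀ F → oneS ⊛ F ≈ F
⊛-identityˡ F = coeffwise λ m → trans (⊛-coeff oneS F m) (∑ᴹ-unit m F)

⊛-identityʳ : ∀ F → F ⊛ oneS ≈ F
⊛-identityʳ F = ≈-trans (⊛-comm F oneS) (⊛-identityˡ F)

⊛-assoc : ∀ F G H → (F ⊛ G) ⊛ H ≈ F ⊛ (G ⊛ H)
⊛-assoc F G H = coeffwise λ m → begin
  ((F ⊛ G) ⊛ H) m
    ≡⟨ ⊛-coeff (F ⊛ G) H m ⟩
  ∑ᴹ[ x ≤ m ] (F ⊛ G) x * H (m ∸ᴹ x)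
    ≡⟨ ∑ᴹ-cong m (λ x → trans (cong (_* H (m ∸ᴹ x)) (⊛-coeff F G x)) (sym (∑ᴹ-*ʳ x (H (m ∸ᴹ x)) _))) ⟩
  ∑ᴹ[ x ≤ m ] ∑ᴹ[ y ≤ x ] F y * G (x ∸ᴹ y) * H (m ∸ᴹ x)
    ≡⟨ ∑ᴹ-assoc m (λ y z w → F y * G z * H w) ⟩
  ∑ᴹ[ y ≤ m ] ∑ᴹ[ z ≤ m ∸ᴹ y ] F y * G z * H ((m ∸ᴹ y) ∸ᴹ z)
    ≡⟨ ∑ᴹ-cong m (λ y → trans (∑ᴹ-cong (m ∸ᴹ y) (λ z → ℤₚ.*-assoc (F y) (G z) _)) (∑ᴹ-*ˡ (m ∸ᴹ y) (F y) _)) ⟩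
  ∑ᴹ[ y ≤ m ] F y * (∑ᴹ[ z ≤ m ∸ᴹ y ] G z * H ((m ∸ᴹ y) ∸ᴹ z))
    ≡⟨ ∑ᴹ-cong m (λ y → cong (F y *_) (⊛-coeff G H (m ∸ᴹ y))) ⟨
  ∑ᴹ[ y ≤ m ] F y * (G ⊛ H) (m ∸ᴹ y)
    ≡⟨ ⊛-coeff F (G ⊛ H) m ⟨
  (F ⊛ (G ⊛ H)) m ∎
  where open ≡-Reasoning

⊛-distribʳ : ∀ F G H → (F ⊕ G) ⊛ H ≈ F ⊛ H ⊕ G ⊛ H
⊛-distribʳ F G H = coeffwise λ m → begin
  ((F ⊕ G) ⊛ H) m                                          ≡⟨ ⊛-coeff (F ⊕ G) H m ⟩
  ∑ᴹ[ x ≤ m ] (F x + G x) * H (m ∸ᴹ x)                     ≡⟨ ∑ᴹ-cong m (λ x → ℤₚ.*-distribʳ-+ (H (m ∸ᴹ x)) (F x) (G x)) ⟩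
  ∑ᴹ[ x ≤ m ] (F x * H (m ∸ᴹ x) + G x * H (m ∸ᴹ x))        ≡⟨ ∑ᴹ-+ m (λ x → F x * H (m ∸ᴹ x)) (λ x → G x * H (m ∸ᴹ x)) ⟩
  (∑ᴹ[ x ≤ m ] F x * H (m ∸ᴹ x)) + (∑ᴹ[ x ≤ m ] G x * H (m ∸ᴹ x)) ≡⟨ cong₂ _+_ (⊛-coeff F H m) (⊛-coeff G H m) ⟨
  (F ⊛ H ⊕ G ⊛ H) m                                        ∎
  where open ≡-Reasoning

⊛-zeroˡ : ∀ F → zeroS ⊛ F ≈ zeroS
⊛-zeroˡ F = coeffwise λ m → trans (⊛-coeff zeroS F m) (∑ᴹ-zero m (λ x → ℤₚ.*-zeroˡ (F (m ∸ᴹ x))))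

⊛-zeroʳ : ∀ F → F ⊛ zeroS ≈ zeroS
⊛-zeroʳ F = ≈-trans (⊛-comm F zeroS) (⊛-zeroˡ F)

·-⊛ : ∀ k F G → (k · F) ⊛ G ≈ k · (F ⊛ G)
·-⊛ k F G = coeffwise λ m → begin
  ((k · F) ⊛ G) m                  ≡⟨ ⊛-coeff (k · F) G m ⟩
  ∑ᴹ[ x ≤ m ] k * F x * G (m ∸ᴹ x) ≡⟨ ∑ᴹ-cong m (λ x → ℤₚ.*-assoc k (F x) (G (m ∸ᴹ x))) ⟩
  ∑ᴹ[ x ≤ m ] k * (F x * G (m ∸ᴹ x)) ≡⟨ ∑ᴹ-*ˡ m k (λ x → F x * G (m ∸ᴹ x)) ⟩
  k * (∑ᴹ[ x ≤ m ] F x * G (m ∸ᴹ x)) ≡⟨ cong (k *_) (⊛-coeff F G m) ⟨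
  (k · (F ⊛ G)) m                  ∎
  where open ≡-Reasoning

⊛-· : ∀ k F G → F ⊛ (k · G) ≈ k · (F ⊛ G)
⊛-· k F G = ≈-trans (⊛-comm F (k · G)) (≈-trans (·-⊛ k G F) (·-cong k (⊛-comm G F)))

⊛-isCommutativeMonoid : IsCommutativeMonoid _≈_ _⊛_ oneS
⊛-isCommutativeMonoid = record
  { isMonoid = record
    { isSemigroup = record
      { isMagma = record { isEquivalence = Setoid.isEquivalence ≈-setoid ; ∙-cong = ⊛-cong }
      ; assoc = ⊛-assoc }
    ; identity = ⊛-identityˡ , ⊛-identityʳ }
  ; comm = ⊛-comm }

⊛-commutativeMonoid : CommutativeMonoid 0ℓ 0ℓ
⊛-commutativeMonoid = record { isCommutativeMonoid = ⊛-isCommutativeMonoid }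

open CommutativeSemigroupProperties (CommutativeMonoid.commutativeSemigroup ⊛-commutativeMonoid)
  using () renaming (interchange to ⊛-interchange)

sumS-coeff : ∀ {A : Set} (f : A → Series) xs m → sumS (map f xs) m ≡ ∑[ x ← xs ] f x m
sumS-coeff f [] m = refl
sumS-coeff f (x ∷ xs) m = cong (f x m +_) (sumS-coeff f xs m)

sumS-cong-local : ∀ {A : Set} {f g : A → Series} {xs} → All (λ x → f x ≈ g x) xs → sumS (map f xs) ≈ sumS (map g xs)
sumS-cong-local {f = f} {g} {xs} f≈g = coeffwise λ m →
  trans (sumS-coeff f xs m) (trans (∑-cong-local (All.map (λ e → coeff e m) f≈g)) (sym (sumS-coeff g xs m)))

sumS-cong : ∀ {A : Set} {f g : A → Series} → (∀ x → f x ≈ g x) → ∀ xs → sumS (map f xs) ≈ sumS (map g xs)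
sumS-cong f≈g xs = sumS-cong-local (All.universal f≈g xs)

sumS-zero : ∀ {A : Set} {f : A → Series} {xs} → All (λ x → f x ≈ zeroS) xs → sumS (map f xs) ≈ zeroS
sumS-zero {f = f} {xs} f≈0 = coeffwise λ m →
  trans (sumS-coeff f xs m) (trans (∑-cong-local (All.map (λ e → coeff e m) f≈0)) (∑-zero (λ _ → refl) xs))

sumS-++ : ∀ {A : Set} (f : A → Series) xs ys → sumS (map f (xs ++ ys)) ≈ sumS (map f xs) ⊕ sumS (map f ys)
sumS-++ f xs ys = coeffwise λ m →
  trans (sumS-coeff f (xs ++ ys) m) (trans (∑-++ (λ x → f x m) xs ys) (sym (cong₂ _+_ (sumS-coeff f xs m) (sumS-coeff f ys m))))

sumS-⊛ : ∀ {A : Set} (f : A → Series) xs G → sumS (map f xs) ⊛ G ≈ sumS (map (λ x → f x ⊛ G) xs)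
sumS-⊛ f [] G = ⊛-zeroˡ G
sumS-⊛ f (x ∷ xs) G = ≈-trans (⊛-distribʳ (f x) (sumS (map f xs)) G) (⊕-cong (≈-refl {f x ⊛ G}) (sumS-⊛ f xs G))

⊛-sumS : ∀ {A : Set} (f : A → Series) xs G → G ⊛ sumS (map f xs) ≈ sumS (map (λ x → G ⊛ f x) xs)
⊛-sumS f xs G = ≈-trans (⊛-comm G (sumS (map f xs))) (≈-trans (sumS-⊛ f xs G) (sumS-cong (λ x → ⊛-comm (f x) G) xs))

prodS-++ : ∀ xs ys → prodS (xs ++ ys) ≈ prodS xs ⊛ prodS ys
prodS-++ [] ys = ≈-sym (⊛-identityˡ (prodS ys))
prodS-++ (x ∷ xs) ys = ≈-trans (⊛-congˡ x (prodS-++ xs ys)) (≈-sym (⊛-assoc x (prodS xs) (prodS ys)))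

prodS-cong-local : ∀ {A : Set} {f g : A → Series} {xs} → All (λ x → f x ≈ g x) xs → prodS (map f xs) ≈ prodS (map g xs)
prodS-cong-local [] = ≈-refl
prodS-cong-local (e ∷ es) = ⊛-cong e (prodS-cong-local es)

prodS-cong : ∀ {A : Set} {f g : A → Series} → (∀ x → f x ≈ g x) → ∀ xs → prodS (map f xs) ≈ prodS (map g xs)
prodS-cong f≈g xs = prodS-cong-local (All.universal f≈g xs)

-- Ring endomorphisms of series, and the shift φβ

record IsRingEndo (f : Series → Series) : Set where
  field
    cong-endo : ∀ {F G} → F ≈ G → f F ≈ f G
    zero-endo : f zeroS ≈ zeroS
    one-endo  : f oneS ≈ oneS
    ⊕-endo    : ∀ F G → f (F ⊕ G) ≈ f F ⊕ f G
    neg-endo  : ∀ F → f (negS F) ≈ negS (f F)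
    ·-endo    : ∀ k F → f (k · F) ≈ k · f F
    ⊛-endo    : ∀ F G → f (F ⊛ G) ≈ f F ⊛ f G

  ⊖S-endo : ∀ F G → f (F ⊖S G) ≈ f F ⊖S f G
  ⊖S-endo F G = ≈-trans (⊕-endo F (negS G)) (⊕-cong (≈-refl {f F}) (neg-endo G))

  sumS-endo : ∀ {A : Set} (g : A → Series) xs → f (sumS (map g xs)) ≈ sumS (map (f ∘ g) xs)
  sumS-endo g [] = zero-endo
  sumS-endo g (x ∷ xs) = ≈-trans (⊕-endo (g x) (sumS (map g xs))) (⊕-cong (≈-refl {f (g x)}) (sumS-endo g xs))

  prodS-endo : ∀ {A : Set} (g : A → Series) xs → f (prodS (map g xs)) ≈ prodS (map (f ∘ g) xs)
  prodS-endo g [] = one-endo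
  prodS-endo g (x ∷ xs) = ≈-trans (⊛-endo (g x) (prodS (map g xs))) (⊛-congˡ (f (g x)) (prodS-endo g xs))

open IsRingEndo public

iter-isRingEndo : ∀ {f} → IsRingEndo f → ∀ k → IsRingEndo (iter k f)
iter-isRingEndo {f} endo zero = record
  { cong-endo = λ F≈G → F≈G ; zero-endo = ≈-refl ; one-endo = ≈-refl ; ⊕-endo = λ _ _ → ≈-refl
  ; neg-endo = λ _ → ≈-refl ; ·-endo = λ _ _ → ≈-refl ; ⊛-endo = λ _ _ → ≈-refl }
iter-isRingEndo {f} endo (suc k) = record
  { cong-endo = λ F≈G → cong-endo endo (cong-endo endoᵏ F≈G)
  ; zero-endo = ≈-trans (cong-endo endo (zero-endo endoᵏ)) (zero-endo endo)
  ; one-endo = ≈-trans (cong-endo endo (one-endo endoᵏ)) (one-endo endo)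
  ; ⊕-endo = λ F G → ≈-trans (cong-endo endo (⊕-endo endoᵏ F G)) (⊕-endo endo (iter k f F) (iter k f G))
  ; neg-endo = λ F → ≈-trans (cong-endo endo (neg-endo endoᵏ F)) (neg-endo endo (iter k f F))
  ; ·-endo = λ c F → ≈-trans (cong-endo endo (·-endo endoᵏ c F)) (·-endo endo c (iter k f F))
  ; ⊛-endo = λ F G → ≈-trans (cong-endo endo (⊛-endo endoᵏ F G)) (⊛-endo endo (iter k f F) (iter k f G))
  }
  where
  endoᵏ = iter-isRingEndo endo k

φβ-⊛-coeff : ∀ F G m → φβ (F ⊛ G) m ≡ (φβ F ⊛ φβ G) m
φβ-⊛-coeff F G (a , c , []) = trans (⊛-coeff F G (a , c , [])) (sym (⊛-coeff (φβ F) (φβ G) (a , c , [])))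
φβ-⊛-coeff F G (a , c , zero ∷ d) = begin
  (F ⊛ G) (a , c , d)
    ≡⟨ ⊛-coeff F G (a , c , d) ⟩
  ∑[ a' ≤ a ] ∑[ c' ≤ c ] ∑[ d' ≤ d ] F (a' , c' , d') * G (subE a a' , subE c c' , subE d d')
    ≡⟨ (∑≤-cong a λ a' → ∑≤-cong c λ c' → sym (trans (∑≤-∷ 0 d _)
         (∑-singleton (λ j → ∑[ t ≤ d ] φβ F (a' , c' , j ∷ t) * φβ G (subE a a' , subE c c' , subE (zero ∷ d) (j ∷ t))) 0))) ⟩
  ∑[ a' ≤ a ] ∑[ c' ≤ c ] ∑[ d' ≤ zero ∷ d ] φβ F (a' , c' , d') * φβ G (subE a a' , subE c c' , subE (zero ∷ d) d')
    ≡⟨ ⊛-coeff (φβ F) (φβ G) (a , c , zero ∷ d) ⟨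
  (φβ F ⊛ φβ G) (a , c , zero ∷ d) ∎
  where open ≡-Reasoning
φβ-⊛-coeff F G (a , c , suc e ∷ d) = sym (trans (⊛-coeff (φβ F) (φβ G) (a , c , suc e ∷ d)) (∑ᴹ-zero (a , c , suc e ∷ d) term≡0))
  where
  term≡0 : ∀ x → φβ F x * φβ G ((a , c , suc e ∷ d) ∸ᴹ x) ≡ 0ℤ
  term≡0 (a' , c' , []) = ℤₚ.*-zeroʳ (F (a' , c' , []))
  term≡0 (a' , c' , zero ∷ d') = ℤₚ.*-zeroʳ (F (a' , c' , d'))
  term≡0 (a' , c' , suc j ∷ d') = ℤₚ.*-zeroˡ (φβ G (subE a a' , subE c c' , (e ∸ j) ∷ subE d d'))

∧-∧-false : ∀ b c → (b ∧ (c ∧ false)) ≡ false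
∧-∧-false b c = trans (cong (b ∧_) (Boolₚ.∧-zeroʳ c)) (Boolₚ.∧-zeroʳ b)

φβ-isRingEndo : IsRingEndo φβ
φβ-isRingEndo = record
  { cong-endo = λ F≈G → coeffwise λ where
      (a , c , []) → coeff F≈G (a , c , [])
      (a , c , zero ∷ d) → coeff F≈G (a , c , d)
      (a , c , suc _ ∷ d) → refl
  ; zero-endo = coeffwise λ where
      (a , c , []) → refl
      (a , c , zero ∷ d) → refl
      (a , c , suc _ ∷ d) → refl
  ; one-endo = coeffwise λ where
      (a , c , []) → refl
      (a , c , zero ∷ d) → refl
      (a , c , suc _ ∷ d) → cong 𝟙 (sym (∧-∧-false (eqExps [] a) (eqExps [] c)))
  ; ⊕-endo = λ F G → coeffwise λ where
      (a , c , []) → refl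
      (a , c , zero ∷ d) → refl
      (a , c , suc _ ∷ d) → refl
  ; neg-endo = λ F → coeffwise λ where
      (a , c , []) → refl
      (a , c , zero ∷ d) → refl
      (a , c , suc _ ∷ d) → refl
  ; ·-endo = λ k F → coeffwise λ where
      (a , c , []) → refl
      (a , c , zero ∷ d) → refl
      (a , c , suc _ ∷ d) → sym (ℤₚ.*-zeroʳ k)
  ; ⊛-endo = λ F G → coeffwise (φβ-⊛-coeff F G)
  }

φβ^ : ℕ → Series → Series
φβ^ k = iter k φβ

φβ^-isRingEndo : ∀ k → IsRingEndo (φβ^ k)
φβ^-isRingEndo = iter-isRingEndo φβ-isRingEndo

φβ-monoS : ∀ a c d → φβ (monoS (a , c , d)) ≈ monoS (a , c , 0 ∷ d)
φβ-monoS a₀ c₀ d₀ = coeffwise λ where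
  (a , c , []) → refl
  (a , c , zero ∷ d) → refl
  (a , c , suc _ ∷ d) → cong 𝟙 (sym (∧-∧-false (eqExps a₀ a) (eqExps c₀ c)))

φβ^-monoS : ∀ k a c d → φβ^ k (monoS (a , c , d)) ≈ monoS (a , c , replicate k 0 ++ d)
φβ^-monoS zero a c d = ≈-refl
φβ^-monoS (suc k) a c d = ≈-trans (cong-endo φβ-isRingEndo (φβ^-monoS k a c d)) (φβ-monoS a c (replicate k 0 ++ d))

-- Determinants

≡⇒≈ : ∀ {F G} → F ≡ G → F ≈ G
≡⇒≈ refl = ≈-refl

sgn : ℕ → ℤ
sgn j = (- 1ℤ) ℤ.^ j

minor : (ℕ → ℕ → Series) → ℕ → ℕ → ℕ → Series
minor M j i' j' = M (suc i') (skip j j')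

cofactorTerm : ℕ → (ℕ → ℕ → Series) → ℕ → Series
cofactorTerm N M j = sgn j · (M 0 j ⊛ det N (minor M j))

skip-≤ : ∀ j j' → skip j j' ≤ suc j'
skip-≤ j j' with j' ℕ.<ᵇ j
... | true = ℕₚ.n≤1+n j'
... | false = ℕₚ.≤-refl

skip-< : ∀ {j j'} → j' < j → skip j j' ≡ j'
skip-< {j} {j'} j'<j with j' ℕ.<ᵇ j in eq
... | true = refl
... | false = contradiction (ℕₚ.<⇒<ᵇ j'<j) (subst T eq)

skip-≥ : ∀ {j j'} → j ≤ j' → skip j j' ≡ suc j'
skip-≥ {j} {j'} j≤j' with j' ℕ.<ᵇ j in eq
... | true = contradiction j≤j' (ℕₚ.<⇒≱ (ℕₚ.<ᵇ⇒< j' j (subst T (sym eq) _)))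
... | false = refl

det-cong : ∀ N {M M'} → (∀ {i j} → i < N → j < N → M i j ≈ M' i j) → det N M ≈ det N M'
det-cong zero M≈M' = ≈-refl
det-cong (suc N) {M} {M'} M≈M' = sumS-cong-local (All-upTo (suc N) λ {j} j<N →
  ·-cong (sgn j) (⊛-cong (M≈M' ℕ.z<s j<N)
    (det-cong N λ i<N j'<N → M≈M' (s≤s i<N) (ℕₚ.≤-trans (s≤s (skip-≤ j _)) (s≤s j'<N)))))

cofactorTerm-zero : ∀ N M j → det N (minor M j) ≈ zeroS → cofactorTerm N M j ≈ zeroS
cofactorTerm-zero N M j det≈0 = coeffwise λ m →
  trans (cong (sgn j *_) (trans (coeff (⊛-congˡ (M 0 j) det≈0) m) (coeff (⊛-zeroʳ (M 0 j)) m))) (ℤₚ.*-zeroʳ (sgn j))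

-- The first p + 1 columns are supported on the first p rows, hence linearly dependent.
det-zero-block : ∀ p N M → (∀ {i j} → p ≤ i → j ≤ p → M i j ≈ zeroS) → p < N → det N M ≈ zeroS
det-zero-block zero (suc N) M M≈0 _ = sumS-zero (All-upTo (suc N) term≈0)
  where
  term≈0 : ∀ {j} → j < suc N → cofactorTerm N M j ≈ zeroS
  term≈0 {zero} _ = coeffwise λ m →
    cong (sgn 0 *_) (trans (coeff (⊛-congʳ (det N (minor M 0)) (M≈0 z≤n z≤n)) m) (coeff (⊛-zeroˡ (det N (minor M 0))) m))
  term≈0 {suc j} (s≤s j<N) = cofactorTerm-zero N M (suc j)
    (det-zero-block zero N (minor M (suc j)) (λ {i} {j'} _ j'≤0 → M≈0 z≤n (subst (_≤ 0) (sym (skip-< (ℕₚ.≤-<-trans j'≤0 ℕ.z<s))) j'≤0))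
                    (ℕₚ.≤-<-trans z≤n j<N))
det-zero-block (suc p) (suc N) M M≈0 (s≤s p<N) = sumS-zero (All.universal (λ j → cofactorTerm-zero N M j
  (det-zero-block p N (minor M j) (λ p≤i j'≤p → M≈0 (s≤s p≤i) (ℕₚ.≤-trans (skip-≤ j _) (s≤s j'≤p))) p<N)) (upTo (suc N)))

det-blockTriangular : ∀ k N M → (∀ {i j} → k ≤ i → j < k → M i j ≈ zeroS) → k ≤ N →
  det N M ≈ det k M ⊛ det (N ∸ k) (λ i j → M (k ℕ.+ i) (k ℕ.+ j))
det-blockTriangular zero N M _ _ = ≈-sym (⊛-identityˡ (det N M))
det-blockTriangular (suc k) (suc N) M M≈0 (s≤s k≤N) = begin
  sumS (map (cofactorTerm N M) (upTo (suc N)))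
    ≡⟨ cong (sumS ∘ map (cofactorTerm N M)) (upTo-split (s≤s k≤N)) ⟩
  sumS (map (cofactorTerm N M) (upTo (suc k) ++ map (suc k ℕ.+_) (upTo (N ∸ k))))
    ≈⟨ sumS-++ (cofactorTerm N M) (upTo (suc k)) _ ⟩
  sumS (map (cofactorTerm N M) (upTo (suc k))) ⊕ sumS (map (cofactorTerm N M) (map (suc k ℕ.+_) (upTo (N ∸ k))))
    ≈⟨ ⊕-cong (sumS-cong-local (All-upTo (suc k) left-term)) right-terms ⟩
  sumS (map (λ j → cofactorTerm k M j ⊛ lower) (upTo (suc k))) ⊕ zeroS
    ≈⟨ coeffwise (λ m → ℤₚ.+-identityʳ _) ⟩
  sumS (map (λ j → cofactorTerm k M j ⊛ lower) (upTo (suc k)))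
    ≈⟨ sumS-⊛ (cofactorTerm k M) (upTo (suc k)) lower ⟨
  det (suc k) M ⊛ lower ∎
  where
  open ≈-Reasoning
  lower : Series
  lower = det (N ∸ k) (λ i j → M (suc k ℕ.+ i) (suc k ℕ.+ j))
  left-term : ∀ {j} → j < suc k → cofactorTerm N M j ≈ cofactorTerm k M j ⊛ lower
  left-term {j} (s≤s j≤k) = begin
    sgn j · (M 0 j ⊛ det N (minor M j))
      ≈⟨ ·-cong (sgn j) (⊛-congˡ (M 0 j) (det-blockTriangular k N (minor M j)
           (λ k≤i j'<k → M≈0 (s≤s k≤i) (ℕₚ.≤-trans (s≤s (skip-≤ j _)) (s≤s j'<k))) k≤N)) ⟩
    sgn j · (M 0 j ⊛ (det k (minor M j) ⊛ det (N ∸ k) (λ i j' → M (suc k ℕ.+ i) (skip j (k ℕ.+ j')))))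
      ≈⟨ ·-cong (sgn j) (⊛-congˡ (M 0 j) (⊛-congˡ (det k (minor M j)) (det-cong (N ∸ k) λ {i} {j'} _ _ →
           ≡⇒≈ (cong (M (suc k ℕ.+ i)) (skip-≥ (ℕₚ.≤-trans j≤k (ℕₚ.m≤m+n k j'))))))) ⟩
    sgn j · (M 0 j ⊛ (det k (minor M j) ⊛ lower))
      ≈⟨ ·-cong (sgn j) (⊛-assoc (M 0 j) (det k (minor M j)) lower) ⟨
    sgn j · ((M 0 j ⊛ det k (minor M j)) ⊛ lower)
      ≈⟨ ·-⊛ (sgn j) (M 0 j ⊛ det k (minor M j)) lower ⟨
    cofactorTerm k M j ⊛ lower ∎
  right-terms : sumS (map (cofactorTerm N M) (map (suc k ℕ.+_) (upTo (N ∸ k)))) ≈ zeroS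
  right-terms = ≈-trans (≡⇒≈ (cong sumS (sym (Listₚ.map-∘ (upTo (N ∸ k))))))
    (sumS-zero (All-upTo (N ∸ k) λ {t} t<N∸k → cofactorTerm-zero N M (suc k ℕ.+ t)
      (det-zero-block k N (minor M (suc k ℕ.+ t))
        (λ {i} {j'} k≤i j'≤k → ≈-trans (≡⇒≈ (cong (M (suc i)) (skip-< (s≤s (ℕₚ.≤-trans j'≤k (ℕₚ.m≤m+n k t))))))
                                       (M≈0 (s≤s k≤i) (s≤s j'≤k)))
        (ℕₚ.≤-<-trans (ℕₚ.m≤m+n k t) (ℕₚ.<-≤-trans (ℕₚ.+-monoʳ-< k t<N∸k) (ℕₚ.≤-reflexive (ℕₚ.m+[n∸m]≡n k≤N)))))))

endo-det : ∀ {f} → IsRingEndo f → ∀ N M → f (det N M) ≈ det N (λ i j → f (M i j))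
endo-det endo zero M = one-endo endo
endo-det {f} endo (suc N) M = ≈-trans (sumS-endo endo (cofactorTerm N M) (upTo (suc N)))
  (sumS-cong (λ j → ≈-trans (·-endo endo (sgn j) (M 0 j ⊛ det N (minor M j)))
    (·-cong (sgn j) (≈-trans (⊛-endo endo (M 0 j) (det N (minor M j))) (⊛-congˡ (f (M 0 j)) (endo-det endo N (minor M j))))))
    (upTo (suc N)))

-- The functions h_m[Y ⊖ Z]

infix 4 _≃_ _≃ᴸ_
_≃_ : List ℤ → List ℤ → Set
xs ≃ ys = ∀ l → getZ xs l ≡ getZ ys l

_≃ᴸ_ : LinComb → LinComb → Set
(x , a , b) ≃ᴸ (x' , a' , b') = (x ≃ x') × (a ≃ a') × (b ≃ b')

prodCoefs-cong : ∀ {cs cs'} → cs ≃ cs' → ∀ i es → prodCoefs cs i es ≡ prodCoefs cs' i es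
prodCoefs-cong cs≃cs' i [] = refl
prodCoefs-cong cs≃cs' i (e ∷ es) = cong₂ _*_ (cong (λ z → binCoef z e) (cs≃cs' i)) (prodCoefs-cong cs≃cs' (suc i) es)

hS-cong : ∀ p {Z Z'} → Z ≃ᴸ Z' → hS p Z ≈ hS p Z'
hS-cong p {x , a , b} {x' , a' , b'} (x≃x' , a≃a' , b≃b') = coeffwise λ where
  (ma , mc , md) → cong (λ z → if does ((ℤ.+ degMon (ma , mc , md)) ℤ.≟ p) then z else 0ℤ)
    (cong₂ _*_ (prodCoefs-cong x≃x' 0 ma) (cong₂ _*_ (prodCoefs-cong a≃a' 0 mc) (prodCoefs-cong b≃b' 0 md)))

hMinus-cong : ∀ m {Y Y' Z Z'} → Y ≃ᴸ Y' → Z ≃ᴸ Z' → hMinus m Y Z ≈ hMinus m Y' Z'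
hMinus-cong m Y≃Y' Z≃Z' = coeffwise λ mon →
  ∑-cong (λ b → coeff (⊛-cong (hS-cong (m + ℤ.+ b) Y≃Y') (hS-cong (ℤ.+ b) Z≃Z')) mon) (upTo (suc (degMon mon)))

prodCoefs-∷ : ∀ x cs i es → prodCoefs (x ∷ cs) (suc i) es ≡ prodCoefs cs i es
prodCoefs-∷ x cs i [] = refl
prodCoefs-∷ x cs i (e ∷ es) = cong (binCoef (getZ cs i) e *_) (prodCoefs-∷ x cs (suc i) es)

binCoef-0-suc : ∀ e → binCoef 0ℤ (suc e) ≡ 0ℤ
binCoef-0-suc e = cong ℤ.+_ (k>n⇒nCk≡0 (ℕₚ.n<1+n e))

shiftβ : ℕ → LinComb → LinComb
shiftβ k (x , a , b) = x , a , replicate k 0ℤ ++ b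

if-same : ∀ b (x : ℤ) → (if b then x else x) ≡ x
if-same true x = refl
if-same false x = refl

φβ-hS-coeff : ∀ p Z m → φβ (hS p Z) m ≡ hS p (shiftβ 1 Z) m
φβ-hS-coeff p Z (a , c , []) = refl
φβ-hS-coeff p (zx , za , zb) (a , c , zero ∷ d) =
  cong (λ z → if does ((ℤ.+ degMon (a , c , d)) ℤ.≟ p) then prodCoefs zx 0 a * (prodCoefs za 0 c * z) else 0ℤ)
       (sym (trans (ℤₚ.*-identityˡ _) (prodCoefs-∷ 0ℤ zb 0 d)))
φβ-hS-coeff p (zx , za , zb) (a , c , suc e ∷ d) = sym (begin
  (if D then prodCoefs zx 0 a * (prodCoefs za 0 c * (binCoef 0ℤ (suc e) * prodCoefs (0ℤ ∷ zb) 1 d)) else 0ℤ)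
    ≡⟨ cong (λ z → if D then prodCoefs zx 0 a * (prodCoefs za 0 c * (z * prodCoefs (0ℤ ∷ zb) 1 d)) else 0ℤ) (binCoef-0-suc e) ⟩
  (if D then prodCoefs zx 0 a * (prodCoefs za 0 c * 0ℤ) else 0ℤ)
    ≡⟨ cong (λ z → if D then z else 0ℤ) (trans (cong (prodCoefs zx 0 a *_) (ℤₚ.*-zeroʳ (prodCoefs za 0 c))) (ℤₚ.*-zeroʳ (prodCoefs zx 0 a))) ⟩
  (if D then 0ℤ else 0ℤ)
    ≡⟨ if-same D 0ℤ ⟩
  0ℤ ∎)
  where
  D = does ((ℤ.+ degMon (a , c , suc e ∷ d)) ℤ.≟ p)
  open ≡-Reasoning

φβ-hMinus : ∀ m Y Z → φβ (hMinus m Y Z) ≈ hMinus m (shiftβ 1 Y) (shiftβ 1 Z)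
φβ-hMinus m Y Z = coeffwise λ mon → trans (unfold mon) (∑-cong (λ b → sym (coeff (shifted b) mon)) (upTo (suc (degMon mon))))
  where
  term : ℕ → Series
  term b = hS (m + ℤ.+ b) Y ⊛ hS (ℤ.+ b) Z
  shifted : ∀ b → hS (m + ℤ.+ b) (shiftβ 1 Y) ⊛ hS (ℤ.+ b) (shiftβ 1 Z) ≈ φβ (term b)
  shifted b = ≈-sym (≈-trans (⊛-endo φβ-isRingEndo (hS (m + ℤ.+ b) Y) (hS (ℤ.+ b) Z))
                             (⊛-cong (coeffwise (φβ-hS-coeff (m + ℤ.+ b) Y)) (coeffwise (φβ-hS-coeff (ℤ.+ b) Z))))
  unfold : ∀ mon → φβ (hMinus m Y Z) mon ≡ ∑[ b ← upTo (suc (degMon mon)) ] φβ (term b) mon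
  unfold (a , c , []) = refl
  unfold (a , c , zero ∷ d) = refl
  unfold (a , c , suc e ∷ d) = sym (∑-zero (λ _ → refl) (upTo (suc (degMon (a , c , suc e ∷ d)))))

φβ^-hMinus : ∀ k m Y Z → φβ^ k (hMinus m Y Z) ≈ hMinus m (shiftβ k Y) (shiftβ k Z)
φβ^-hMinus zero m (x , a , b) (x' , a' , b') = ≈-refl
φβ^-hMinus (suc k) m Y Z = ≈-trans (cong-endo φβ-isRingEndo (φβ^-hMinus k m Y Z)) (≈-trans (φβ-hMinus m (shiftβ k Y) (shiftβ k Z)) (shift-suc Y Z))
  where
  shift-suc : ∀ Y Z → hMinus m (shiftβ 1 (shiftβ k Y)) (shiftβ 1 (shiftβ k Z)) ≈ hMinus m (shiftβ (suc k) Y) (shiftβ (suc k) Z)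
  shift-suc (x , a , b) (x' , a' , b') = ≈-refl

NegSumIn : ℕ → ℕ → List ℤ → Set
NegSumIn lo hi cs = ∀ l → (getZ cs l ≡ 0ℤ) ⊎ ((getZ cs l ≡ -[1+ 0 ]) × lo ≤ l × l < hi)

NegSumIn-resp : ∀ {lo hi cs cs'} → cs ≃ cs' → NegSumIn lo hi cs' → NegSumIn lo hi cs
NegSumIn-resp cs≃cs' neg l with neg l
... | inj₁ c≡0 = inj₁ (trans (cs≃cs' l) c≡0)
... | inj₂ (c≡-1 , lo≤l , l<hi) = inj₂ (trans (cs≃cs' l) c≡-1 , lo≤l , l<hi)

getZ-addZ : ∀ xs ys l → getZ (addZ xs ys) l ≡ getZ xs l + getZ ys l
getZ-addZ [] ys l = sym (ℤₚ.+-identityˡ _)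
getZ-addZ (x ∷ xs) [] l = sym (ℤₚ.+-identityʳ _)
getZ-addZ (x ∷ xs) (y ∷ ys) zero = refl
getZ-addZ (x ∷ xs) (y ∷ ys) (suc l) = getZ-addZ xs ys l

getZ-neg : ∀ xs l → getZ (map -_ xs) l ≡ - getZ xs l
getZ-neg [] l = refl
getZ-neg (x ∷ xs) zero = refl
getZ-neg (x ∷ xs) (suc l) = getZ-neg xs l

getZ-ones : ∀ m l → getZ (ones m) l ≡ 𝟙 (l ℕ.<ᵇ m)
getZ-ones zero l = refl
getZ-ones (suc m) zero = refl
getZ-ones (suc m) (suc l) = getZ-ones m l

ones-∸-ones : ∀ {a b} → a ≤ b → NegSumIn a b (addZ (ones a) (map -_ (ones b)))
ones-∸-ones {a} {b} a≤b l rewrite getZ-addZ (ones a) (map -_ (ones b)) l | getZ-neg (ones b) l | getZ-ones a l | getZ-ones b l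
  with l ℕ.<ᵇ a in l<a | l ℕ.<ᵇ b in l<b
... | true | true = inj₁ refl
... | true | false = contradiction (ℕₚ.<⇒<ᵇ (ℕₚ.<-≤-trans (ℕₚ.<ᵇ⇒< l a (subst T (sym l<a) _)) a≤b)) (subst T l<b)
... | false | true = inj₂ (refl , ℕₚ.≮⇒≥ (λ l<a' → subst T l<a (ℕₚ.<⇒<ᵇ l<a')) , ℕₚ.<ᵇ⇒< l b (subst T (sym l<b) _))
... | false | false = inj₁ refl

binCoef-0 : ∀ e → binCoef 0ℤ e ≢ 0ℤ → e ≡ 0
binCoef-0 zero _ = refl
binCoef-0 (suc e) ≢0 = contradiction (binCoef-0-suc e) ≢0

binCoef-1 : ∀ e → binCoef -[1+ 0 ] e ≢ 0ℤ → e ≤ 1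
binCoef-1 zero _ = z≤n
binCoef-1 (suc zero) _ = ℕₚ.≤-refl
binCoef-1 (suc (suc e)) ≢0 = contradiction
  (trans (cong (λ z → ((- 1ℤ) ℤ.^ suc (suc e)) * ℤ.+ z) (k>n⇒nCk≡0 {1} {suc (suc e)} (s≤s (s≤s z≤n)))) (ℤₚ.*-zeroʳ ((- 1ℤ) ℤ.^ suc (suc e))))
  ≢0

*-≢0ˡ : ∀ x y → x * y ≢ 0ℤ → x ≢ 0ℤ
*-≢0ˡ x y xy≢0 refl = xy≢0 refl

*-≢0ʳ : ∀ x y → x * y ≢ 0ℤ → y ≢ 0ℤ
*-≢0ʳ x y xy≢0 refl = xy≢0 (ℤₚ.*-zeroʳ x)

prodCoefs-degree : ∀ {lo hi cs} → NegSumIn lo hi cs → ∀ i es → prodCoefs cs i es ≢ 0ℤ → sumℕ es ≤ hi ∸ (lo ℕ.⊔ i)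
prodCoefs-degree neg i [] _ = z≤n
prodCoefs-degree {lo} {hi} {cs} neg i (e ∷ es) ≢0 with neg i
... | inj₁ c≡0 = begin
  e ℕ.+ sumℕ es        ≡⟨ cong (ℕ._+ sumℕ es) (binCoef-0 e (subst (λ z → binCoef z e ≢ 0ℤ) c≡0 head≢0)) ⟩
  sumℕ es              ≤⟨ rest ⟩
  hi ∸ (lo ℕ.⊔ suc i)  ≤⟨ ℕₚ.∸-monoʳ-≤ hi (ℕₚ.⊔-monoʳ-≤ lo (ℕₚ.n≤1+n i)) ⟩
  hi ∸ (lo ℕ.⊔ i)      ∎
  where
  open ℕₚ.≤-Reasoning
  head≢0 = *-≢0ˡ (binCoef (getZ cs i) e) _ ≢0
  rest = prodCoefs-degree neg (suc i) es (*-≢0ʳ (binCoef (getZ cs i) e) _ ≢0)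
... | inj₂ (c≡-1 , lo≤i , i<hi) = begin
  e ℕ.+ sumℕ es        ≤⟨ ℕₚ.+-mono-≤ (binCoef-1 e (subst (λ z → binCoef z e ≢ 0ℤ) c≡-1 head≢0)) rest ⟩
  1 ℕ.+ (hi ∸ suc i)   ≡⟨ ℕₚ.+-∸-assoc 1 i<hi ⟨
  hi ∸ i               ≡⟨ cong (hi ∸_) (ℕₚ.m≤n⇒m⊔n≡n lo≤i) ⟨
  hi ∸ (lo ℕ.⊔ i)      ∎
  where
  open ℕₚ.≤-Reasoning
  head≢0 = *-≢0ˡ (binCoef (getZ cs i) e) _ ≢0
  rest = subst (λ z → sumℕ es ≤ hi ∸ z) (ℕₚ.m≤n⇒m⊔n≡n (ℕₚ.m≤n⇒m≤1+n lo≤i))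
           (prodCoefs-degree neg (suc i) es (*-≢0ʳ (binCoef (getZ cs i) e) _ ≢0))

if-does-0 : ∀ {P : Set} (dec : Dec P) {x : ℤ} → (P → x ≡ 0ℤ) → (if does dec then x else 0ℤ) ≡ 0ℤ
if-does-0 (yes p) x≡0 = x≡0 p
if-does-0 (no _) _ = refl

hS-negative : ∀ {z} Y → z ℤ.< 0ℤ → hS z Y ≈ zeroS
hS-negative {z} Y z<0 = coeffwise λ m → if-does-0 ((ℤ.+ degMon m) ℤ.≟ z)
  λ deg≡z → contradiction (subst (0ℤ ℤ.≤_) deg≡z (ℤ.+≤+ z≤n)) (ℤₚ.<⇒≱ z<0)

hS-aboveDegree : ∀ {b lo₁ hi₁ lo₂ hi₂ za zb} → NegSumIn lo₁ hi₁ za → NegSumIn lo₂ hi₂ zb →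
  (hi₁ ∸ lo₁) ℕ.+ (hi₂ ∸ lo₂) < b → hS (ℤ.+ b) ([] , za , zb) ≈ zeroS
hS-aboveDegree {b} {lo₁} {hi₁} {lo₂} {hi₂} {za} {zb} negα negβ deg<b = coeffwise coeff≡0
  where
  open ℕₚ.≤-Reasoning
  x-degree : ∀ a {y} → prodCoefs [] 0 a * y ≢ 0ℤ → sumℕ a ≤ 0
  x-degree a ≢0 = prodCoefs-degree {0} {0} (λ _ → inj₁ refl) 0 a (*-≢0ˡ (prodCoefs [] 0 a) _ ≢0)
  α-degree : ∀ a c d → prodCoefs [] 0 a * (prodCoefs za 0 c * prodCoefs zb 0 d) ≢ 0ℤ → sumℕ c ≤ hi₁ ∸ lo₁
  α-degree a c d ≢0 = subst (λ z → sumℕ c ≤ hi₁ ∸ z) (ℕₚ.⊔-identityʳ lo₁)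
    (prodCoefs-degree negα 0 c (*-≢0ˡ (prodCoefs za 0 c) _ (*-≢0ʳ (prodCoefs [] 0 a) _ ≢0)))
  β-degree : ∀ a c d → prodCoefs [] 0 a * (prodCoefs za 0 c * prodCoefs zb 0 d) ≢ 0ℤ → sumℕ d ≤ hi₂ ∸ lo₂
  β-degree a c d ≢0 = subst (λ z → sumℕ d ≤ hi₂ ∸ z) (ℕₚ.⊔-identityʳ lo₂)
    (prodCoefs-degree negβ 0 d (*-≢0ʳ (prodCoefs za 0 c) _ (*-≢0ʳ (prodCoefs [] 0 a) _ ≢0)))
  coeff≡0 : ∀ m → hS (ℤ.+ b) ([] , za , zb) m ≡ 0ℤ
  coeff≡0 (a , c , d) = if-does-0 ((ℤ.+ degMon (a , c , d)) ℤ.≟ ℤ.+ b) λ deg≡b →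
    decidable-stable (_ ℤ.≟ 0ℤ) λ ≢0 → ℕₚ.<⇒≱ deg<b (begin
      b                                        ≡⟨ ℤₚ.+-injective deg≡b ⟨
      sumℕ a ℕ.+ sumℕ c ℕ.+ sumℕ d             ≤⟨ ℕₚ.+-mono-≤ (ℕₚ.+-mono-≤ (x-degree a ≢0) (α-degree a c d ≢0)) (β-degree a c d ≢0) ⟩
      0 ℕ.+ (hi₁ ∸ lo₁) ℕ.+ (hi₂ ∸ lo₂)        ∎)

-- The determinantal formula

entry : ℕ → ℕ → ℕ → ℕ → ℕ → ℕ → Series
entry λᵢ μⱼ rⱼ sᵢ i j =
  hMinus (ℤ.+ λᵢ ℤ.- ℤ.+ μⱼ ℤ.- ℤ.+ suc i + ℤ.+ suc j) (Xint rⱼ sᵢ) (Aα λᵢ ⊞ negL (Aα μⱼ) ⊞ negL (Bβ i) ⊞ Bβ (suc j))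

matrix : List ℕ → List ℕ → List ℕ → List ℕ → ℕ → ℕ → Series
matrix la mu r s i j = entry (la ! suc i) (mu ! suc j) (r ! suc j) (s ! suc i) i j

factor : ℕ → ℕ → Series
factor i l = oneS ⊖S monoS (expOf l 1 , [] , expOf i 1)

rowFactor : List ℕ → List ℕ → ℕ → Series
rowFactor r s i = prodS (map (factor i) (range (r ! i ℕ.⊔ 1) (s ! i)))

prefactor : ℕ → List ℕ → List ℕ → Series
prefactor n r s = prodS (map (rowFactor r s) (range 1 n))

addZ-[]ʳ : ∀ xs → addZ xs [] ≡ xs
addZ-[]ʳ [] = refl
addZ-[]ʳ (x ∷ xs) = refl

⊖-<0 : ∀ {m n} → m < n → m ℤ.⊖ n ℤ.< 0ℤ
⊖-<0 {m} {suc n} (s≤s m≤n) =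
  subst (ℤ._< 0ℤ) (sym (trans (ℤₚ.⊖-< (s≤s m≤n)) (cong (λ t → - ℤ.+ t) (ℕₚ.+-∸-assoc 1 m≤n)))) ℤ.-<+

-- With 0-based i and j, λᵢ ≤ μⱼ and j < i give Z = -(α_{λᵢ+1} + … + α_{μⱼ}) - (β_{j+2} + … + β_i),
-- minus a sum of P = (μⱼ - λᵢ) + (i - j - 1) variables.
regroup : ∀ l m si sj b → l + - m + - si + sj + b ≡ l + sj + b + - (m + si)
regroup = solve-∀

entry-zero : ∀ {λᵢ μⱼ rⱼ sᵢ i j} → λᵢ ≤ μⱼ → j < i → entry λᵢ μⱼ rⱼ sᵢ i j ≈ zeroS
entry-zero {λᵢ} {μⱼ} {rⱼ} {sᵢ} {i} {j} λ≤μ j<i = coeffwise λ mon → ∑-zero (λ b → term≡0 b mon) (upTo (suc (degMon mon)))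
  where
  m₀ = ℤ.+ λᵢ ℤ.- ℤ.+ μⱼ ℤ.- ℤ.+ suc i + ℤ.+ suc j
  Y = Xint rⱼ sᵢ
  Z = Aα λᵢ ⊞ negL (Aα μⱼ) ⊞ negL (Bβ i) ⊞ Bβ (suc j)
  P = (μⱼ ∸ λᵢ) ℕ.+ (i ∸ suc j)
  negα : NegSumIn λᵢ μⱼ (proj₁ (proj₂ Z))
  negα = subst (NegSumIn λᵢ μⱼ)
    (sym (trans (addZ-[]ʳ (addZ (addZ (ones λᵢ) (map -_ (ones μⱼ))) [])) (addZ-[]ʳ (addZ (ones λᵢ) (map -_ (ones μⱼ))))))
    (ones-∸-ones λ≤μ)
  negβ : NegSumIn (suc j) i (proj₂ (proj₂ Z))
  negβ = NegSumIn-resp {cs = addZ (map -_ (ones i)) (ones (suc j))} {cs' = addZ (ones (suc j)) (map -_ (ones i))} (λ l → begin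
      getZ (addZ (map -_ (ones i)) (ones (suc j))) l           ≡⟨ getZ-addZ (map -_ (ones i)) (ones (suc j)) l ⟩
      getZ (map -_ (ones i)) l + getZ (ones (suc j)) l         ≡⟨ ℤₚ.+-comm (getZ (map -_ (ones i)) l) _ ⟩
      getZ (ones (suc j)) l + getZ (map -_ (ones i)) l         ≡⟨ getZ-addZ (ones (suc j)) (map -_ (ones i)) l ⟨
      getZ (addZ (ones (suc j)) (map -_ (ones i))) l           ∎)
    (ones-∸-ones j<i)
    where open ≡-Reasoning
  index<0 : ∀ {b} → b ≤ P → m₀ + ℤ.+ b ℤ.< 0ℤ
  index<0 {b} b≤P = subst (ℤ._< 0ℤ) (sym m₀+b≡) (⊖-<0 (begin-strict
      λᵢ ℕ.+ suc j ℕ.+ b                               ≤⟨ ℕₚ.+-monoʳ-≤ (λᵢ ℕ.+ suc j) b≤P ⟩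
      λᵢ ℕ.+ suc j ℕ.+ ((μⱼ ∸ λᵢ) ℕ.+ (i ∸ suc j))     ≡⟨ +-interchangeℕ λᵢ (suc j) (μⱼ ∸ λᵢ) (i ∸ suc j) ⟩
      (λᵢ ℕ.+ (μⱼ ∸ λᵢ)) ℕ.+ (suc j ℕ.+ (i ∸ suc j))   ≡⟨ cong₂ ℕ._+_ (ℕₚ.m+[n∸m]≡n λ≤μ) (ℕₚ.m+[n∸m]≡n j<i) ⟩
      μⱼ ℕ.+ i                                         <⟨ ℕₚ.+-monoʳ-< μⱼ (ℕₚ.n<1+n i) ⟩
      μⱼ ℕ.+ suc i                                     ∎))
    where
    open ℕₚ.≤-Reasoning
    m₀+b≡ : m₀ + ℤ.+ b ≡ (λᵢ ℕ.+ suc j ℕ.+ b) ℤ.⊖ (μⱼ ℕ.+ suc i)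
    m₀+b≡ = trans (regroup (ℤ.+ λᵢ) (ℤ.+ μⱼ) (ℤ.+ suc i) (ℤ.+ suc j) (ℤ.+ b))
      (trans (cong₂ (λ u v → u + - v) (trans (cong (_+ ℤ.+ b) (sym (ℤₚ.pos-+ λᵢ (suc j)))) (sym (ℤₚ.pos-+ (λᵢ ℕ.+ suc j) b)))
                                      (sym (ℤₚ.pos-+ μⱼ (suc i))))
             (ℤₚ.m-n≡m⊖n (λᵢ ℕ.+ suc j ℕ.+ b) (μⱼ ℕ.+ suc i)))
  term≡0 : ∀ b → hS (m₀ + ℤ.+ b) Y ⊛ hS (ℤ.+ b) Z ≋ zeroS
  term≡0 b with b ℕₚ.≤? P
  ... | yes b≤P = coeff (≈-trans (⊛-congʳ (hS (ℤ.+ b) Z) (hS-negative Y (index<0 b≤P))) (⊛-zeroˡ (hS (ℤ.+ b) Z)))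
  ... | no b≰P = coeff (≈-trans (⊛-congˡ (hS (m₀ + ℤ.+ b) Y) (hS-aboveDegree negα negβ (ℕₚ.≰⇒> b≰P))) (⊛-zeroʳ (hS (m₀ + ℤ.+ b) Y)))

shiftβ-Xint : ∀ k ρ σ → shiftβ k (Xint ρ σ) ≃ᴸ Xint ρ σ
shiftβ-Xint k ρ σ = (λ _ → refl) , (λ _ → refl) , zeros {k}
  where
  zeros : ∀ {k} l → getZ (replicate k 0ℤ ++ []) l ≡ 0ℤ
  zeros {zero} l = refl
  zeros {suc k} zero = refl
  zeros {suc k} (suc l) = zeros {k} l

βpart-shift : ∀ k a b l → getZ (replicate k 0ℤ ++ addZ (map -_ (ones a)) (ones b)) l ≡ getZ (addZ (map -_ (ones (k ℕ.+ a))) (ones (k ℕ.+ b))) l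
βpart-shift zero a b l = refl
βpart-shift (suc k) a b zero = refl
βpart-shift (suc k) a b (suc l) = βpart-shift k a b l

index-shift : ∀ l m k i j → l + - m + - i + j ≡ l + - m + - (k + i) + (k + j)
index-shift = solve-∀

φβ^-entry : ∀ k λᵢ μⱼ rⱼ sᵢ i j → φβ^ k (entry λᵢ μⱼ rⱼ sᵢ i j) ≈ entry λᵢ μⱼ rⱼ sᵢ (k ℕ.+ i) (k ℕ.+ j)
φβ^-entry k λᵢ μⱼ rⱼ sᵢ i j = ≈-trans (φβ^-hMinus k m₀ (Xint rⱼ sᵢ) Z)
  (≈-trans (hMinus-cong m₀ (shiftβ-Xint k rⱼ sᵢ) ((λ _ → refl) , (λ _ → refl) , shifted-β))
           (≡⇒≈ (cong (λ m → hMinus m (Xint rⱼ sᵢ) Z') index≡)))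
  where
  m₀ = ℤ.+ λᵢ ℤ.- ℤ.+ μⱼ ℤ.- ℤ.+ suc i + ℤ.+ suc j
  Z = Aα λᵢ ⊞ negL (Aα μⱼ) ⊞ negL (Bβ i) ⊞ Bβ (suc j)
  Z' = Aα λᵢ ⊞ negL (Aα μⱼ) ⊞ negL (Bβ (k ℕ.+ i)) ⊞ Bβ (suc (k ℕ.+ j))
  shifted-β : replicate k 0ℤ ++ proj₂ (proj₂ Z) ≃ proj₂ (proj₂ Z')
  shifted-β l = trans (βpart-shift k i (suc j) l) (cong (λ b → getZ (addZ (map -_ (ones (k ℕ.+ i))) (ones b)) l) (ℕₚ.+-suc k j))
  index≡ : m₀ ≡ ℤ.+ λᵢ ℤ.- ℤ.+ μⱼ ℤ.- ℤ.+ suc (k ℕ.+ i) + ℤ.+ suc (k ℕ.+ j)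
  index≡ = trans (index-shift (ℤ.+ λᵢ) (ℤ.+ μⱼ) (ℤ.+ k) (ℤ.+ suc i) (ℤ.+ suc j))
    (sym (cong₂ (λ u v → ℤ.+ λᵢ + - ℤ.+ μⱼ + - u + v)
      (trans (cong ℤ.+_ (sym (ℕₚ.+-suc k i))) (ℤₚ.pos-+ k (suc i)))
      (trans (cong ℤ.+_ (sym (ℕₚ.+-suc k j))) (ℤₚ.pos-+ k (suc j)))))

replicate-++-++ : ∀ {A : Set} (x : A) k t ys → replicate k x ++ (replicate t x ++ ys) ≡ replicate (k ℕ.+ t) x ++ ys
replicate-++-++ x zero t ys = refl
replicate-++-++ x (suc k) t ys = cong (x ∷_) (replicate-++-++ x k t ys)

φβ^-factor : ∀ k t l → φβ^ k (factor (suc t) l) ≈ factor (suc (k ℕ.+ t)) l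
φβ^-factor k t l = ≈-trans (⊖S-endo (φβ^-isRingEndo k) oneS (monoS (expOf l 1 , [] , expOf (suc t) 1)))
  (⊖S-cong (one-endo (φβ^-isRingEndo k))
    (≈-trans (φβ^-monoS k (expOf l 1) [] (expOf (suc t) 1))
             (≡⇒≈ (cong (λ d → monoS (expOf l 1 , [] , d)) (replicate-++-++ 0 k t [ 1 ])))))

take-! : ∀ k (xs : List ℕ) {i} → i ≤ k → take k xs ! i ≡ xs ! i
take-! k xs {zero} _ = refl
take-! (suc k) [] {suc i} _ = refl
take-! (suc k) (x ∷ xs) {suc zero} _ = refl
take-! (suc k) (x ∷ xs) {suc (suc i)} (s≤s i<k) = take-! k xs i<k

drop-! : ∀ k (xs : List ℕ) i → drop k xs ! suc i ≡ xs ! suc (k ℕ.+ i)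
drop-! zero xs i = refl
drop-! (suc k) [] i = refl
drop-! (suc k) (x ∷ xs) i = drop-! k xs i

length-take-≤ : ∀ k (xs : List ℕ) → k ≤ length xs → length (take k xs) ≡ k
length-take-≤ k xs k≤len = trans (Listₚ.length-take k xs) (ℕₚ.m≤n⇒m⊓n≡m k≤len)

partition-antitone : ∀ {xs} → IsPartition xs → ∀ {a b} → 1 ≤ a → a ≤ b → xs ! b ≤ xs ! a
partition-antitone {xs} part {a} {b} 1≤a a≤b = subst (λ z → xs ! z ≤ xs ! a) (ℕₚ.m+[n∸m]≡n a≤b) (go (b ∸ a))
  where
  go : ∀ d → xs ! (a ℕ.+ d) ≤ xs ! a
  go zero = ℕₚ.≤-reflexive (cong (xs !_) (ℕₚ.+-identityʳ a))
  go (suc d) = ℕₚ.≤-trans (subst (λ z → xs ! z ≤ xs ! (a ℕ.+ d)) (sym (ℕₚ.+-suc a d)) (part (a ℕ.+ d) (ℕₚ.≤-trans 1≤a (ℕₚ.m≤m+n a d))))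
                          (go d)

prefactor-upTo : ∀ n r s → prefactor n r s ≡ prodS (map (rowFactor r s ∘ suc) (upTo n))
prefactor-upTo n r s = cong prodS (sym (Listₚ.map-∘ (upTo n)))

rowFactor-take : ∀ k r s {t} → t < k → rowFactor (take k r) (take k s) (suc t) ≡ rowFactor r s (suc t)
rowFactor-take k r s {t} t<k = cong₂ (λ u v → prodS (map (factor (suc t)) (range (u ℕ.⊔ 1) v))) (take-! k r t<k) (take-! k s t<k)

φβ^-rowFactor-drop : ∀ k r s t → φβ^ k (rowFactor (drop k r) (drop k s) (suc t)) ≈ rowFactor r s (suc (k ℕ.+ t))
φβ^-rowFactor-drop k r s t = begin
  φβ^ k (rowFactor (drop k r) (drop k s) (suc t))
    ≡⟨ cong₂ (λ u v → φβ^ k (prodS (map (factor (suc t)) (range (u ℕ.⊔ 1) v)))) (drop-! k r t) (drop-! k s t) ⟩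
  φβ^ k (prodS (map (factor (suc t)) bounds))
    ≈⟨ prodS-endo (φβ^-isRingEndo k) (factor (suc t)) bounds ⟩
  prodS (map (φβ^ k ∘ factor (suc t)) bounds)
    ≈⟨ prodS-cong (φβ^-factor k t) bounds ⟩
  rowFactor r s (suc (k ℕ.+ t)) ∎
  where
  open ≈-Reasoning
  bounds = range (r ! suc (k ℕ.+ t) ℕ.⊔ 1) (s ! suc (k ℕ.+ t))

prefactor-split : ∀ {k n} r s → k ≤ n →
  prefactor n r s ≈ prefactor k (take k r) (take k s) ⊛ φβ^ k (prefactor (n ∸ k) (drop k r) (drop k s))
prefactor-split {k} {n} r s k≤n = begin
  prefactor n r s
    ≡⟨ prefactor-upTo n r s ⟩
  prodS (map row (upTo n))
    ≡⟨ cong (prodS ∘ map row) (upTo-split k≤n) ⟩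
  prodS (map row (upTo k ++ map (k ℕ.+_) (upTo (n ∸ k))))
    ≡⟨ cong prodS (trans (Listₚ.map-++ row (upTo k) _) (cong (map row (upTo k) ++_) (sym (Listₚ.map-∘ (upTo (n ∸ k)))))) ⟩
  prodS (map row (upTo k) ++ map (row ∘ (k ℕ.+_)) (upTo (n ∸ k)))
    ≈⟨ prodS-++ (map row (upTo k)) _ ⟩
  prodS (map row (upTo k)) ⊛ prodS (map (row ∘ (k ℕ.+_)) (upTo (n ∸ k)))
    ≈⟨ ⊛-cong top bottom ⟨
  prefactor k (take k r) (take k s) ⊛ φβ^ k (prefactor (n ∸ k) (drop k r) (drop k s)) ∎
  where
  open ≈-Reasoning
  row = rowFactor r s ∘ suc
  top : prefactor k (take k r) (take k s) ≈ prodS (map row (upTo k))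
  top = ≈-trans (≡⇒≈ (prefactor-upTo k (take k r) (take k s)))
                (prodS-cong-local (All-upTo k λ t<k → ≡⇒≈ (rowFactor-take k r s t<k)))
  bottom : φβ^ k (prefactor (n ∸ k) (drop k r) (drop k s)) ≈ prodS (map (row ∘ (k ℕ.+_)) (upTo (n ∸ k)))
  bottom = ≈-trans (cong-endo (φβ^-isRingEndo k) (≡⇒≈ (prefactor-upTo (n ∸ k) (drop k r) (drop k s))))
    (≈-trans (prodS-endo (φβ^-isRingEndo k) (rowFactor (drop k r) (drop k s) ∘ suc) (upTo (n ∸ k)))
             (prodS-cong (φβ^-rowFactor-drop k r s) (upTo (n ∸ k))))

entry-cong : ∀ {λᵢ λᵢ' μⱼ μⱼ' rⱼ rⱼ' sᵢ sᵢ'} → λᵢ ≡ λᵢ' → μⱼ ≡ μⱼ' → rⱼ ≡ rⱼ' → sᵢ ≡ sᵢ' →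
  ∀ i j → entry λᵢ μⱼ rⱼ sᵢ i j ≡ entry λᵢ' μⱼ' rⱼ' sᵢ' i j
entry-cong refl refl refl refl i j = refl

module _ (k : ℕ) (la mu r s : List ℕ) where

  matrix-take : ∀ {i j} → i < k → j < k → matrix (take k la) (take k mu) (take k r) (take k s) i j ≈ matrix la mu r s i j
  matrix-take {i} {j} i<k j<k = ≡⇒≈ (entry-cong (take-! k la i<k) (take-! k mu j<k) (take-! k r j<k) (take-! k s i<k) i j)

  φβ^-matrix-drop : ∀ i j → φβ^ k (matrix (drop k la) (drop k mu) (drop k r) (drop k s) i j) ≈ matrix la mu r s (k ℕ.+ i) (k ℕ.+ j)
  φβ^-matrix-drop i j = ≈-trans
    (cong-endo (φβ^-isRingEndo k) (≡⇒≈ (entry-cong (drop-! k la i) (drop-! k mu j) (drop-! k r j) (drop-! k s i) i j)))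
    (φβ^-entry k (la ! suc (k ℕ.+ i)) (mu ! suc (k ℕ.+ j)) (r ! suc (k ℕ.+ j)) (s ! suc (k ℕ.+ i)) i j)

  matrix-lowerLeft : IsPartition la → IsPartition mu → la ! suc k ≤ mu ! k →
    ∀ {i j} → k ≤ i → j < k → matrix la mu r s i j ≈ zeroS
  matrix-lowerLeft la-part mu-part λ≤μ {i} {j} k≤i j<k = entry-zero {rⱼ = r ! suc j} {sᵢ = s ! suc i} (begin
      la ! suc i   ≤⟨ partition-antitone la-part (s≤s z≤n) (s≤s k≤i) ⟩
      la ! suc k   ≤⟨ λ≤μ ⟩
      mu ! k       ≤⟨ partition-antitone mu-part (s≤s z≤n) j<k ⟩
      mu ! suc j   ∎)
    (ℕₚ.<-≤-trans j<k k≤i)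
    where open ℕₚ.≤-Reasoning

  det-matrix-split : ∀ {n} → k ≤ n → IsPartition la → IsPartition mu → la ! suc k ≤ mu ! k →
    det n (matrix la mu r s) ≈ det k (matrix (take k la) (take k mu) (take k r) (take k s))
                               ⊛ φβ^ k (det (n ∸ k) (matrix (drop k la) (drop k mu) (drop k r) (drop k s)))
  det-matrix-split {n} k≤n la-part mu-part λ≤μ = ≈-trans
    (det-blockTriangular k n (matrix la mu r s) (matrix-lowerLeft la-part mu-part λ≤μ) k≤n)
    (⊛-cong (det-cong k λ i<k j<k → ≈-sym (matrix-take i<k j<k))
            (≈-sym (≈-trans (endo-det (φβ^-isRingEndo k) (n ∸ k) _) (det-cong (n ∸ k) λ {i} {j} _ _ → φβ^-matrix-drop i j))))

Gt-unfold-length : ∀ {n} la mu r s → length la ≡ n → Gt la mu r s ≡ prefactor n r s ⊛ det n (matrix la mu r s)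
Gt-unfold-length la mu r s refl = refl

Gt-split : ∀ {n k} la mu r s → length la ≡ n → k ≤ n → IsPartition la → IsPartition mu → la ! suc k ≤ mu ! k →
  Gt la mu r s ≈ Gt (take k la) (take k mu) (take k r) (take k s) ⊛ φβ^ k (Gt (drop k la) (drop k mu) (drop k r) (drop k s))
Gt-split {n} {k} la mu r s len≡n k≤n la-part mu-part λ≤μ = begin
  Gt la mu r s
    ≡⟨ Gt-unfold-length la mu r s len≡n ⟩
  prefactor n r s ⊛ det n (matrix la mu r s)
    ≈⟨ ⊛-cong (prefactor-split r s k≤n) (det-matrix-split k la mu r s k≤n la-part mu-part λ≤μ) ⟩
  (P₁ ⊛ φβ^ k P₂) ⊛ (D₁ ⊛ φβ^ k D₂)
    ≈⟨ ⊛-interchange P₁ (φβ^ k P₂) D₁ (φβ^ k D₂) ⟩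
  (P₁ ⊛ D₁) ⊛ (φβ^ k P₂ ⊛ φβ^ k D₂)
    ≈⟨ ⊛-congˡ (P₁ ⊛ D₁) (⊛-endo (φβ^-isRingEndo k) P₂ D₂) ⟨
  (P₁ ⊛ D₁) ⊛ φβ^ k (P₂ ⊛ D₂)
    ≡⟨ cong₂ (λ u v → u ⊛ φβ^ k v)
         (Gt-unfold-length (take k la) (take k mu) (take k r) (take k s) (length-take-≤ k la (subst (k ≤_) (sym len≡n) k≤n)))
         (Gt-unfold-length (drop k la) (drop k mu) (drop k r) (drop k s) (trans (Listₚ.length-drop k la) (cong (_∸ k) len≡n))) ⟨
  Gt (take k la) (take k mu) (take k r) (take k s) ⊛ φβ^ k (Gt (drop k la) (drop k mu) (drop k r) (drop k s)) ∎
  where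
  open ≈-Reasoning
  P₁ = prefactor k (take k r) (take k s)
  P₂ = prefactor (n ∸ k) (drop k r) (drop k s)
  D₁ = det k (matrix (take k la) (take k mu) (take k r) (take k s))
  D₂ = det (n ∸ k) (matrix (drop k la) (drop k mu) (drop k r) (drop k s))

relabel : (Cell → Cell) → Cell × Entry → Cell × Entry
relabel g (c , e) = g c , e

fillings-∷ : ∀ N D c cs (f : Filling → ℤ) →
  ∑ f (fillings N D (c ∷ cs)) ≡ ∑[ e ← entries N D ] ∑[ T ← fillings N D cs ] f ((c , e) ∷ T)
fillings-∷ N D c cs f = trans (∑-concatMap f (λ e → map ((c , e) ∷_) (fillings N D cs)) (entries N D))
                              (∑-cong (λ e → ∑-map f ((c , e) ∷_) (fillings N D cs)) (entries N D))

fillings-cong : ∀ N D cs {f g : Filling → ℤ} → (∀ T → map proj₁ T ≡ cs → f T ≡ g T) →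
  ∑ f (fillings N D cs) ≡ ∑ g (fillings N D cs)
fillings-cong N D [] f≗g = cong (_+ 0ℤ) (f≗g [] refl)
fillings-cong N D (c ∷ cs) {f} {g} f≗g = begin
  ∑ f (fillings N D (c ∷ cs))                                  ≡⟨ fillings-∷ N D c cs f ⟩
  ∑[ e ← entries N D ] ∑[ T ← fillings N D cs ] f ((c , e) ∷ T) ≡⟨ ∑-cong (λ e → fillings-cong N D cs λ T T↦cs → f≗g ((c , e) ∷ T) (cong (c ∷_) T↦cs)) (entries N D) ⟩
  ∑[ e ← entries N D ] ∑[ T ← fillings N D cs ] g ((c , e) ∷ T) ≡⟨ fillings-∷ N D c cs g ⟨
  ∑ g (fillings N D (c ∷ cs))                                  ∎
  where open ≡-Reasoning

fillings-++ : ∀ N D cs₁ cs₂ (f : Filling → ℤ) →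
  ∑ f (fillings N D (cs₁ ++ cs₂)) ≡ ∑[ T₁ ← fillings N D cs₁ ] ∑[ T₂ ← fillings N D cs₂ ] f (T₁ ++ T₂)
fillings-++ N D [] cs₂ f = sym (ℤₚ.+-identityʳ _)
fillings-++ N D (c ∷ cs₁) cs₂ f = trans (fillings-∷ N D c (cs₁ ++ cs₂) f) (trans
  (∑-cong (λ e → fillings-++ N D cs₁ cs₂ (λ T → f ((c , e) ∷ T))) (entries N D))
  (sym (fillings-∷ N D c cs₁ (λ T₁ → ∑[ T₂ ← fillings N D cs₂ ] f (T₁ ++ T₂)))))

fillings-map : ∀ N D (g : Cell → Cell) cs (f : Filling → ℤ) →
  ∑ f (fillings N D (map g cs)) ≡ ∑[ T ← fillings N D cs ] f (map (relabel g) T)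
fillings-map N D g [] f = refl
fillings-map N D g (c ∷ cs) f = trans (fillings-∷ N D (g c) (map g cs) f) (trans
  (∑-cong (λ e → fillings-map N D g cs (λ T → f ((g c , e) ∷ T))) (entries N D))
  (sym (fillings-∷ N D c cs (λ T → f (map (relabel g) T)))))

valuesAtMost : ℕ → Entry → Bool
valuesAtMost N e = allB (λ p → proj₁ p ℕ.≤ᵇ N) e

EntryFits : ℕ → ℕ → Entry → Bool
EntryFits N D e = (length e ℕ.≤ᵇ D) ∧ valuesAtMost N e

FillingFits : ℕ → ℕ → Filling → Bool
FillingFits N D T = allB (EntryFits N D ∘ proj₂) T

suc+≰ᵇ : ∀ n t → (suc (n ℕ.+ t) ℕ.≤ᵇ n) ≡ false
suc+≰ᵇ zero t = refl
suc+≰ᵇ (suc n) t = suc+≰ᵇ n t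

letters : ℕ → List (ℕ × Bool)
letters v = (suc v , false) ∷ (suc v , true) ∷ []

listsLen-suc : ∀ N L (h : Entry → ℤ) → ∑ h (listsLen N (suc L)) ≡ ∑[ p ← alphabet N ] ∑[ e ← listsLen N L ] h (p ∷ e)
listsLen-suc N L h = trans (∑-concatMap h (λ p → map (p ∷_) (listsLen N L)) (alphabet N))
                           (∑-cong (λ p → ∑-map h (p ∷_) (listsLen N L)) (alphabet N))

∑-alphabet-restrict : ∀ {N₀ N} → N₀ ≤ N → (g : ℕ × Bool → ℤ) → (∀ p → (proj₁ p ℕ.≤ᵇ N₀) ≡ false → g p ≡ 0ℤ) →
  ∑ g (alphabet N) ≡ ∑ g (alphabet N₀)
∑-alphabet-restrict {N₀} {N} N₀≤N g g≡0 = begin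
  ∑ g (alphabet N)                                                           ≡⟨ cong (∑ g ∘ concatMap letters) (upTo-split N₀≤N) ⟩
  ∑ g (concatMap letters (upTo N₀ ++ map (N₀ ℕ.+_) (upTo (N ∸ N₀))))         ≡⟨ cong (∑ g) (Listₚ.concatMap-++ letters (upTo N₀) _) ⟩
  ∑ g (alphabet N₀ ++ concatMap letters (map (N₀ ℕ.+_) (upTo (N ∸ N₀))))     ≡⟨ ∑-++ g (alphabet N₀) _ ⟩
  ∑ g (alphabet N₀) + ∑ g (concatMap letters (map (N₀ ℕ.+_) (upTo (N ∸ N₀)))) ≡⟨ cong (∑ g (alphabet N₀) +_) beyond ⟩
  ∑ g (alphabet N₀) + 0ℤ                                                     ≡⟨ ℤₚ.+-identityʳ _ ⟩
  ∑ g (alphabet N₀)                                                          ∎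
  where
  open ≡-Reasoning
  beyond : ∑ g (concatMap letters (map (N₀ ℕ.+_) (upTo (N ∸ N₀)))) ≡ 0ℤ
  beyond = trans (∑-concatMap g letters (map (N₀ ℕ.+_) (upTo (N ∸ N₀))))
    (trans (∑-map (λ v → ∑ g (letters v)) (N₀ ℕ.+_) (upTo (N ∸ N₀)))
      (∑-zero (λ t → cong₂ _+_ (g≡0 _ (suc+≰ᵇ N₀ t)) (cong (_+ 0ℤ) (g≡0 _ (suc+≰ᵇ N₀ t)))) (upTo (N ∸ N₀))))

listsLen-restrict : ∀ {N₀ N} → N₀ ≤ N → ∀ L (h : Entry → ℤ) → (∀ e → valuesAtMost N₀ e ≡ false → h e ≡ 0ℤ) →
  ∑ h (listsLen N L) ≡ ∑ h (listsLen N₀ L)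
listsLen-restrict N₀≤N zero h h≡0 = refl
listsLen-restrict {N₀} {N} N₀≤N (suc L) h h≡0 = begin
  ∑ h (listsLen N (suc L))                           ≡⟨ listsLen-suc N L h ⟩
  ∑[ p ← alphabet N ] ∑[ e ← listsLen N L ] h (p ∷ e)  ≡⟨ ∑-cong (λ p → listsLen-restrict N₀≤N L (λ e → h (p ∷ e)) (λ e big →
                                                           h≡0 (p ∷ e) (trans (cong ((proj₁ p ℕ.≤ᵇ N₀) ∧_) big) (Boolₚ.∧-zeroʳ _)))) (alphabet N) ⟩
  ∑[ p ← alphabet N ] ∑[ e ← listsLen N₀ L ] h (p ∷ e) ≡⟨ ∑-alphabet-restrict N₀≤N _ (λ p big →
                                                           ∑-zero (λ e → h≡0 (p ∷ e) (cong (_∧ valuesAtMost N₀ e) big)) (listsLen N₀ L)) ⟩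
  ∑[ p ← alphabet N₀ ] ∑[ e ← listsLen N₀ L ] h (p ∷ e) ≡⟨ listsLen-suc N₀ L h ⟨
  ∑ h (listsLen N₀ (suc L))                          ∎
  where open ≡-Reasoning

listsLen-zero : ∀ N L (h : Entry → ℤ) → (∀ e → length e ≡ L → h e ≡ 0ℤ) → ∑ h (listsLen N L) ≡ 0ℤ
listsLen-zero N zero h h≡0 = cong (_+ 0ℤ) (h≡0 [] refl)
listsLen-zero N (suc L) h h≡0 = trans (listsLen-suc N L h)
  (∑-zero (λ p → listsLen-zero N L (λ e → h (p ∷ e)) (λ e len≡L → h≡0 (p ∷ e) (cong suc len≡L))) (alphabet N))

entries-restrict : ∀ {N₀ N D₀ D} → N₀ ≤ N → D₀ ≤ D → (h : Entry → ℤ) → (∀ e → EntryFits N₀ D₀ e ≡ false → h e ≡ 0ℤ) →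
  ∑ h (entries N D) ≡ ∑ h (entries N₀ D₀)
entries-restrict {N₀} {N} {D₀} {D} N₀≤N D₀≤D h h≡0 = begin
  ∑ h (entries N D)
    ≡⟨ ∑-concatMap h (listsLen N) (upTo (suc D)) ⟩
  ∑[ L ← upTo (suc D) ] ∑ h (listsLen N L)
    ≡⟨ cong (∑ (λ L → ∑ h (listsLen N L))) (upTo-split (s≤s D₀≤D)) ⟩
  ∑[ L ← upTo (suc D₀) ++ map (suc D₀ ℕ.+_) (upTo (D ∸ D₀)) ] ∑ h (listsLen N L)
    ≡⟨ ∑-++ (λ L → ∑ h (listsLen N L)) (upTo (suc D₀)) _ ⟩
  (∑[ L ← upTo (suc D₀) ] ∑ h (listsLen N L)) + (∑[ L ← map (suc D₀ ℕ.+_) (upTo (D ∸ D₀)) ] ∑ h (listsLen N L))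
    ≡⟨ cong₂ _+_ (∑-cong (λ L → listsLen-restrict N₀≤N L h (λ e big → h≡0 e (trans (cong ((length e ℕ.≤ᵇ D₀) ∧_) big) (Boolₚ.∧-zeroʳ _)))) (upTo (suc D₀)))
                 (trans (∑-map (λ L → ∑ h (listsLen N L)) (suc D₀ ℕ.+_) (upTo (D ∸ D₀)))
                        (∑-zero (λ t → listsLen-zero N (suc D₀ ℕ.+ t) h (λ e len≡ →
                           h≡0 e (trans (cong (λ n → (n ℕ.≤ᵇ D₀) ∧ valuesAtMost N₀ e) len≡) (cong (_∧ valuesAtMost N₀ e) (suc+≰ᵇ D₀ t))))) (upTo (D ∸ D₀)))) ⟩
  (∑[ L ← upTo (suc D₀) ] ∑ h (listsLen N₀ L)) + 0ℤ
    ≡⟨ ℤₚ.+-identityʳ _ ⟩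
  ∑[ L ← upTo (suc D₀) ] ∑ h (listsLen N₀ L)
    ≡⟨ ∑-concatMap h (listsLen N₀) (upTo (suc D₀)) ⟨
  ∑ h (entries N₀ D₀) ∎
  where open ≡-Reasoning

fillings-restrict : ∀ {N₀ N D₀ D} → N₀ ≤ N → D₀ ≤ D → ∀ cs (f : Filling → ℤ) → (∀ T → FillingFits N₀ D₀ T ≡ false → f T ≡ 0ℤ) →
  ∑ f (fillings N D cs) ≡ ∑ f (fillings N₀ D₀ cs)
fillings-restrict N₀≤N D₀≤D [] f f≡0 = refl
fillings-restrict {N₀} {N} {D₀} {D} N₀≤N D₀≤D (c ∷ cs) f f≡0 = begin
  ∑ f (fillings N D (c ∷ cs))                                     ≡⟨ fillings-∷ N D c cs f ⟩
  ∑[ e ← entries N D ] ∑[ T ← fillings N D cs ] f ((c , e) ∷ T)    ≡⟨ ∑-cong rest (entries N D) ⟩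
  ∑[ e ← entries N D ] ∑[ T ← fillings N₀ D₀ cs ] f ((c , e) ∷ T)  ≡⟨ entries-restrict N₀≤N D₀≤D (λ e → ∑[ T ← fillings N₀ D₀ cs ] f ((c , e) ∷ T))
                                                                         (λ e big → ∑-zero (λ T → f≡0 ((c , e) ∷ T) (cong (_∧ FillingFits N₀ D₀ T) big)) (fillings N₀ D₀ cs)) ⟩
  ∑[ e ← entries N₀ D₀ ] ∑[ T ← fillings N₀ D₀ cs ] f ((c , e) ∷ T) ≡⟨ fillings-∷ N₀ D₀ c cs f ⟨
  ∑ f (fillings N₀ D₀ (c ∷ cs))                                   ∎
  where
  open ≡-Reasoning
  rest : ∀ e → ∑[ T ← fillings N D cs ] f ((c , e) ∷ T) ≡ ∑[ T ← fillings N₀ D₀ cs ] f ((c , e) ∷ T)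
  rest e with EntryFits N₀ D₀ e in fits
  ... | true = fillings-restrict N₀≤N D₀≤D cs (λ T → f ((c , e) ∷ T)) (λ T big → f≡0 ((c , e) ∷ T) (trans (cong (EntryFits N₀ D₀ e ∧_) big) (Boolₚ.∧-zeroʳ _)))
  ... | false = trans (∑-zero (λ T → f≡0 ((c , e) ∷ T) (cong (_∧ FillingFits N₀ D₀ T) fits)) (fillings N D cs))
                      (sym (∑-zero (λ T → f≡0 ((c , e) ∷ T) (cong (_∧ FillingFits N₀ D₀ T) fits)) (fillings N₀ D₀ cs)))

-- The combinatorial formula as a sum of weights

expAt : Exps → ℕ → ℕ
expAt [] i = 0
expAt (x ∷ xs) zero = x
expAt (x ∷ xs) (suc i) = expAt xs i

≡ᵇ-true⇒≡ : ∀ m n → (m ℕ.≡ᵇ n) ≡ true → m ≡ n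
≡ᵇ-true⇒≡ m n eq = ℕₚ.≡ᵇ⇒≡ m n (subst T (sym eq) _)

∧-true : ∀ {b c} → (b ∧ c) ≡ true → (b ≡ true) × (c ≡ true)
∧-true {true} {true} _ = refl , refl

eqExps-sound : ∀ x y → eqExps x y ≡ true → ∀ i → expAt x i ≡ expAt y i
eqExps-sound [] [] eq i = refl
eqExps-sound [] (y ∷ ys) eq zero = sym (≡ᵇ-true⇒≡ y 0 (proj₁ (∧-true eq)))
eqExps-sound [] (y ∷ ys) eq (suc i) = eqExps-sound [] ys (proj₂ (∧-true {y ℕ.≡ᵇ 0} eq)) i
eqExps-sound (x ∷ xs) [] eq zero = ≡ᵇ-true⇒≡ x 0 (proj₁ (∧-true eq))
eqExps-sound (x ∷ xs) [] eq (suc i) = eqExps-sound xs [] (proj₂ (∧-true {x ℕ.≡ᵇ 0} eq)) i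
eqExps-sound (x ∷ xs) (y ∷ ys) eq zero = ≡ᵇ-true⇒≡ x y (proj₁ (∧-true eq))
eqExps-sound (x ∷ xs) (y ∷ ys) eq (suc i) = eqExps-sound xs ys (proj₂ (∧-true {x ℕ.≡ᵇ y} eq)) i

sumℕ-eqExps : ∀ x y → eqExps x y ≡ true → sumℕ x ≡ sumℕ y
sumℕ-eqExps [] [] eq = refl
sumℕ-eqExps [] (y ∷ ys) eq = cong₂ ℕ._+_ (sym (≡ᵇ-true⇒≡ y 0 (proj₁ (∧-true eq)))) (sumℕ-eqExps [] ys (proj₂ (∧-true {y ℕ.≡ᵇ 0} eq)))
sumℕ-eqExps (x ∷ xs) [] eq = cong₂ ℕ._+_ (≡ᵇ-true⇒≡ x 0 (proj₁ (∧-true eq))) (sumℕ-eqExps xs [] (proj₂ (∧-true {x ℕ.≡ᵇ 0} eq)))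
sumℕ-eqExps (x ∷ xs) (y ∷ ys) eq = cong₂ ℕ._+_ (≡ᵇ-true⇒≡ x y (proj₁ (∧-true eq))) (sumℕ-eqExps xs ys (proj₂ (∧-true {x ℕ.≡ᵇ y} eq)))

expAt-addE : ∀ x y i → expAt (addE x y) i ≡ expAt x i ℕ.+ expAt y i
expAt-addE [] y i = refl
expAt-addE (x ∷ xs) [] i = sym (ℕₚ.+-identityʳ _)
expAt-addE (x ∷ xs) (y ∷ ys) zero = refl
expAt-addE (x ∷ xs) (y ∷ ys) (suc i) = expAt-addE xs ys i

expAt-addE-≤ˡ : ∀ x y i → expAt x i ≤ expAt (addE x y) i
expAt-addE-≤ˡ x y i = subst (expAt x i ≤_) (sym (expAt-addE x y i)) (ℕₚ.m≤m+n (expAt x i) (expAt y i))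

expAt-addE-≤ʳ : ∀ x y i → expAt y i ≤ expAt (addE x y) i
expAt-addE-≤ʳ x y i = subst (expAt y i ≤_) (sym (expAt-addE x y i)) (ℕₚ.m≤n+m (expAt y i) (expAt x i))

expAt-beyond : ∀ a {i} → length a ≤ i → expAt a i ≡ 0
expAt-beyond [] _ = refl
expAt-beyond (x ∷ a) {suc i} (s≤s len≤i) = expAt-beyond a len≤i

expAt-expOf : ∀ m → expAt (expOf (suc m) 1) m ≡ 1
expAt-expOf zero = refl
expAt-expOf (suc m) = expAt-expOf m

sumℕ-addE : ∀ x y → sumℕ (addE x y) ≡ sumℕ x ℕ.+ sumℕ y
sumℕ-addE [] y = refl
sumℕ-addE (x ∷ xs) [] = sym (ℕₚ.+-identityʳ _)
sumℕ-addE (x ∷ xs) (y ∷ ys) = trans (cong ((x ℕ.+ y) ℕ.+_) (sumℕ-addE xs ys)) (+-interchangeℕ x y (sumℕ xs) (sumℕ ys))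

sumℕ-expOf : ∀ i → sumℕ (expOf i 1) ≡ 1
sumℕ-expOf i = go (i ∸ 1)
  where
  go : ∀ m → sumℕ (replicate m 0 ++ [ 1 ]) ≡ 1
  go zero = refl
  go (suc m) = go m

xExps : Entry → Exps
xExps e = foldr (λ p acc → addE (expOf (proj₁ p) 1) acc) [] e

sumℕ-xExps : ∀ e → sumℕ (xExps e) ≡ length e
sumℕ-xExps [] = refl
sumℕ-xExps (p ∷ e) = trans (sumℕ-addE (expOf (proj₁ p) 1) (xExps e)) (cong₂ ℕ._+_ (sumℕ-expOf (proj₁ p)) (sumℕ-xExps e))

T⇒≡true : ∀ {b} → T b → b ≡ true
T⇒≡true {true} _ = refl

≤⇒≤ᵇ-true : ∀ {m n} → m ≤ n → (m ℕ.≤ᵇ n) ≡ true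
≤⇒≤ᵇ-true = T⇒≡true ∘ ℕₚ.≤⇒≤ᵇ

valuesAtMost-length : ∀ e a → (∀ i → expAt (xExps e) i ≤ expAt a i) → valuesAtMost (length a) e ≡ true
valuesAtMost-length [] a _ = refl
valuesAtMost-length ((zero , b) ∷ e) a e≤a = valuesAtMost-length e a (λ i → ℕₚ.≤-trans (expAt-addE-≤ʳ (expOf 0 1) (xExps e) i) (e≤a i))
valuesAtMost-length ((suc v , b) ∷ e) a e≤a = cong₂ _∧_ (≤⇒≤ᵇ-true v<len) (valuesAtMost-length e a (λ i → ℕₚ.≤-trans (expAt-addE-≤ʳ (expOf (suc v) 1) (xExps e) i) (e≤a i)))
  where
  1≤a[v] : 1 ≤ expAt a v
  1≤a[v] = ℕₚ.≤-trans (ℕₚ.≤-reflexive (sym (expAt-expOf v))) (ℕₚ.≤-trans (expAt-addE-≤ˡ (expOf (suc v) 1) (xExps e) v) (e≤a v))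
  v<len : suc v ≤ length a
  v<len = ℕₚ.≰⇒> λ len≤v → contradiction (subst (1 ≤_) (expAt-beyond a len≤v) 1≤a[v]) λ ()

xPart : Filling → Exps
xPart T = proj₁ (monT T)

fits-of-xPart : ∀ T a → (∀ i → expAt (xPart T) i ≤ expAt a i) → sumℕ (xPart T) ≤ sumℕ a →
  FillingFits (length a) (sumℕ a) T ≡ true
fits-of-xPart [] a _ _ = refl
fits-of-xPart ((c , e) ∷ T) a T≤a ΣT≤Σa = cong₂ _∧_
  (cong₂ _∧_ (≤⇒≤ᵇ-true length≤) (valuesAtMost-length e a λ i → ℕₚ.≤-trans (expAt-addE-≤ˡ (xExps e) (xPart T) i) (T≤a i)))
  (fits-of-xPart T a (λ i → ℕₚ.≤-trans (expAt-addE-≤ʳ (xExps e) (xPart T) i) (T≤a i)) (ℕₚ.≤-trans (ℕₚ.m≤n+m _ _) split))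
  where
  split : sumℕ (xExps e) ℕ.+ sumℕ (xPart T) ≤ sumℕ a
  split = subst (_≤ sumℕ a) (sumℕ-addE (xExps e) (xPart T)) ΣT≤Σa
  length≤ : length e ≤ sumℕ a
  length≤ = subst (_≤ sumℕ a) (sumℕ-xExps e) (ℕₚ.≤-trans (ℕₚ.m≤m+n _ _) split)

eqExps-xPart-unfit : ∀ T a → FillingFits (length a) (sumℕ a) T ≡ false → eqExps (xPart T) a ≡ false
eqExps-xPart-unfit T a unfit with eqExps (xPart T) a in eq
... | false = refl
... | true = contradiction (trans (sym (fits-of-xPart T a (λ i → ℕₚ.≤-reflexive (eqExps-sound (xPart T) a eq i))
                                                          (ℕₚ.≤-reflexive (sumℕ-eqExps (xPart T) a eq)))) unfit) λ ()

weight : List ℕ → List ℕ → Filling → Series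
weight r s T = if validTableau r s T then signT T · monoS (monT T) else zeroS

G≤ : ℕ → ℕ → List ℕ → List ℕ → List ℕ → List ℕ → Series
G≤ N D la mu r s = sumS (map (weight r s) (fillings N D (cells la mu)))

*-𝟙 : ∀ x b → x * 𝟙 b ≡ (if b then x else 0ℤ)
*-𝟙 x true = ℤₚ.*-identityʳ x
*-𝟙 x false = ℤₚ.*-zeroʳ x

weight-coeff : ∀ r s T m → weight r s T m ≡ (if validTableau r s T ∧ eqMon (monT T) m then signT T else 0ℤ)
weight-coeff r s T m with validTableau r s T
... | true = *-𝟙 (signT T) (eqMon (monT T) m)
... | false = refl

-- Raising the enumeration bounds beyond those used by G only adds fillings of other monomials.
G≤-coeff : ∀ {N D} la mu r s a c d → length a ≤ N → sumℕ a ≤ D → G≤ N D la mu r s (a , c , d) ≡ G la mu r s (a , c , d)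
G≤-coeff {N} {D} la mu r s a c d len≤N Σ≤D = begin
  G≤ N D la mu r s (a , c , d)
    ≡⟨ sumS-coeff (weight r s) (fillings N D (cells la mu)) (a , c , d) ⟩
  ∑[ T ← fillings N D (cells la mu) ] weight r s T (a , c , d)
    ≡⟨ fillings-restrict len≤N Σ≤D (cells la mu) (λ T → weight r s T (a , c , d)) unfit⇒0 ⟩
  ∑[ T ← fillings (length a) (sumℕ a) (cells la mu) ] weight r s T (a , c , d)
    ≡⟨ ∑-cong (λ T → weight-coeff r s T (a , c , d)) (fillings (length a) (sumℕ a) (cells la mu)) ⟩
  G la mu r s (a , c , d) ∎
  where
  open ≡-Reasoning
  unfit⇒0 : ∀ T → FillingFits (length a) (sumℕ a) T ≡ false → weight r s T (a , c , d) ≡ 0ℤ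
  unfit⇒0 T unfit = trans (weight-coeff r s T (a , c , d)) (trans
    (cong (λ b → if validTableau r s T ∧ (b ∧ (eqExps (proj₁ (proj₂ (monT T))) c ∧ eqExps (proj₂ (proj₂ (monT T))) d)) then signT T else 0ℤ)
          (eqExps-xPart-unfit T a unfit))
    (cong (λ b → if b then signT T else 0ℤ) (Boolₚ.∧-zeroʳ (validTableau r s T))))

-- Splitting a skew shape between rows k and k + 1

rowCells : List ℕ → List ℕ → ℕ → List Cell
rowCells la mu i = map (i ,_) (range (suc (mu ! i)) (la ! i))

cells-rows : ∀ la mu → cells la mu ≡ concatMap (rowCells la mu ∘ suc) (upTo (length la))
cells-rows la mu = Listₚ.concatMap-map (rowCells la mu) suc (upTo (length la))

shiftRow : ℕ → Cell → Cell
shiftRow k (i , j) = k ℕ.+ i , j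

cells-split : ∀ k la mu → k ≤ length la →
  cells la mu ≡ cells (take k la) (take k mu) ++ map (shiftRow k) (cells (drop k la) (drop k mu))
cells-split k la mu k≤len = begin
  cells la mu
    ≡⟨ cells-rows la mu ⟩
  concatMap row (upTo (length la))
    ≡⟨ cong (concatMap row) (upTo-split k≤len) ⟩
  concatMap row (upTo k ++ map (k ℕ.+_) (upTo (length la ∸ k)))
    ≡⟨ Listₚ.concatMap-++ row (upTo k) _ ⟩
  concatMap row (upTo k) ++ concatMap row (map (k ℕ.+_) (upTo (length la ∸ k)))
    ≡⟨ cong₂ _++_ top bottom ⟩
  cells (take k la) (take k mu) ++ map (shiftRow k) (cells (drop k la) (drop k mu)) ∎
  where
  open ≡-Reasoning
  row = rowCells la mu ∘ suc
  top : concatMap row (upTo k) ≡ cells (take k la) (take k mu)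
  top = begin
    concatMap row (upTo k)
      ≡⟨ cong concat (Listₚ.map-cong-local (All-upTo k λ {t} t<k →
           cong₂ (λ u v → map (suc t ,_) (range (suc u) v)) (sym (take-! k mu t<k)) (sym (take-! k la t<k)))) ⟩
    concatMap (rowCells (take k la) (take k mu) ∘ suc) (upTo k)
      ≡⟨ cong (concatMap (rowCells (take k la) (take k mu) ∘ suc) ∘ upTo) (length-take-≤ k la k≤len) ⟨
    concatMap (rowCells (take k la) (take k mu) ∘ suc) (upTo (length (take k la)))
      ≡⟨ cells-rows (take k la) (take k mu) ⟨
    cells (take k la) (take k mu) ∎
  bottom : concatMap row (map (k ℕ.+_) (upTo (length la ∸ k))) ≡ map (shiftRow k) (cells (drop k la) (drop k mu))
  bottom = begin
    concatMap row (map (k ℕ.+_) (upTo (length la ∸ k)))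
      ≡⟨ Listₚ.concatMap-map row (k ℕ.+_) (upTo (length la ∸ k)) ⟩
    concatMap (row ∘ (k ℕ.+_)) (upTo (length la ∸ k))
      ≡⟨ Listₚ.concatMap-cong (λ t → trans (cong₂ (λ i js → map (i ,_) js) (sym (ℕₚ.+-suc k t))
                                              (cong₂ (λ u v → range (suc u) v) (sym (drop-! k mu t)) (sym (drop-! k la t))))
                                        (Listₚ.map-∘ (range (suc (drop k mu ! suc t)) (drop k la ! suc t))))
                                 (upTo (length la ∸ k)) ⟩
    concatMap (map (shiftRow k) ∘ rowCells (drop k la) (drop k mu) ∘ suc) (upTo (length la ∸ k))
      ≡⟨ Listₚ.map-concatMap (shiftRow k) (rowCells (drop k la) (drop k mu) ∘ suc) (upTo (length la ∸ k)) ⟨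
    map (shiftRow k) (concatMap (rowCells (drop k la) (drop k mu) ∘ suc) (upTo (length la ∸ k)))
      ≡⟨ cong (map (shiftRow k)) (trans (cong (concatMap (rowCells (drop k la) (drop k mu) ∘ suc) ∘ upTo) (sym (Listₚ.length-drop k la)))
                                        (sym (cells-rows (drop k la) (drop k mu)))) ⟩
    map (shiftRow k) (cells (drop k la) (drop k mu)) ∎

All-range : ∀ a b → All (λ x → a ≤ x × x ≤ b) (range a b)
All-range a b = Allₚ.map⁺ (All-upTo (suc b ∸ a) λ {t} t<b+1-a →
  ℕₚ.m≤m+n a t , ℕₚ.≤-pred (subst (a ℕ.+ t <_) (ℕₚ.m+[n∸m]≡n (a≤b+1 t<b+1-a)) (ℕₚ.+-monoʳ-< a t<b+1-a)))
  where
  a≤b+1 : ∀ {t} → t < suc b ∸ a → a ≤ suc b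
  a≤b+1 {t} t< = ℕₚ.≮⇒≥ λ b+1<a → contradiction (subst (t <_) (ℕₚ.m≤n⇒m∸n≡0 (ℕₚ.<⇒≤ b+1<a)) t<) λ ()

All-cells : ∀ la mu {P : Cell → Set} → (∀ {i j} → 1 ≤ i → i ≤ length la → mu ! i < j → j ≤ la ! i → P (i , j)) →
  All P (cells la mu)
All-cells la mu P-cell = subst (All _) (sym (cells-rows la mu))
  (Allₚ.concat⁺ (Allₚ.map⁺ (All-upTo (length la) λ {t} t<len →
    Allₚ.map⁺ (All.map (λ (μ<j , j≤λ) → P-cell (s≤s z≤n) t<len μ<j j≤λ) (All-range (suc (mu ! suc t)) (la ! suc t))))))

allB-++ : ∀ {A : Set} (p : A → Bool) xs ys → allB p (xs ++ ys) ≡ (allB p xs ∧ allB p ys)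
allB-++ p [] ys = refl
allB-++ p (x ∷ xs) ys = trans (cong (p x ∧_) (allB-++ p xs ys)) (sym (Boolₚ.∧-assoc (p x) _ _))

allB-map : ∀ {A B : Set} (p : B → Bool) (f : A → B) xs → allB p (map f xs) ≡ allB (p ∘ f) xs
allB-map p f [] = refl
allB-map p f (x ∷ xs) = cong (p (f x) ∧_) (allB-map p f xs)

allB-cong-local : ∀ {A : Set} {p q : A → Bool} {xs} → All (λ x → p x ≡ q x) xs → allB p xs ≡ allB q xs
allB-cong-local [] = refl
allB-cong-local (e ∷ es) = cong₂ _∧_ e (allB-cong-local es)

allB-true : ∀ {A : Set} {p : A → Bool} {xs} → All (λ x → p x ≡ true) xs → allB p xs ≡ true
allB-true [] = refl
allB-true (e ∷ es) = cong₂ _∧_ e (allB-true es)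

≢⇒≡ᵇ-false : ∀ {m n} → m ≢ n → (m ℕ.≡ᵇ n) ≡ false
≢⇒≡ᵇ-false {m} {n} m≢n with m ℕ.≡ᵇ n in eq
... | true = contradiction (≡ᵇ-true⇒≡ m n eq) m≢n
... | false = refl

+-≡ᵇ-+ : ∀ k m n → ((k ℕ.+ m) ℕ.≡ᵇ (k ℕ.+ n)) ≡ (m ℕ.≡ᵇ n)
+-≡ᵇ-+ zero m n = refl
+-≡ᵇ-+ (suc k) m n = +-≡ᵇ-+ k m n

eqCell-row≢ : ∀ {i' i} j' j → i' ≢ i → eqCell (i' , j') (i , j) ≡ false
eqCell-row≢ j' j i'≢i = cong (_∧ (j' ℕ.≡ᵇ j)) (≢⇒≡ᵇ-false i'≢i)

eqCell-col≢ : ∀ i' i {j' j} → j' ≢ j → eqCell (i' , j') (i , j) ≡ false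
eqCell-col≢ i' i j'≢j = trans (cong ((i' ℕ.≡ᵇ i) ∧_) (≢⇒≡ᵇ-false j'≢j)) (Boolₚ.∧-zeroʳ _)

adjacentOK : Cell × Entry → Cell × Entry → Bool
adjacentOK ((i , j) , e) (c' , e') =
  (if eqCell c' (i , suc j) then maxE e ℕ.≤ᵇ minE e' else true) ∧
  (if eqCell c' (suc i , j) then maxE e ℕ.<ᵇ minE e' else true)

adjacentOK-apart : ∀ i j e c' e' → eqCell c' (i , suc j) ≡ false → eqCell c' (suc i , j) ≡ false →
  adjacentOK ((i , j) , e) (c' , e') ≡ true
adjacentOK-apart i j e c' e' right≢ below≢ =
  cong₂ (λ u v → (if u then maxE e ℕ.≤ᵇ minE e' else true) ∧ (if v then maxE e ℕ.<ᵇ minE e' else true)) right≢ below≢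

adjacentOK-shift : ∀ k q q' → adjacentOK (relabel (shiftRow k) q) (relabel (shiftRow k) q') ≡ adjacentOK q q'
adjacentOK-shift k ((i , j) , e) ((i' , j') , e') = cong₂ (λ u v → (if u then maxE e ℕ.≤ᵇ minE e' else true) ∧ (if v then maxE e ℕ.<ᵇ minE e' else true))
  (cong (_∧ (j' ℕ.≡ᵇ suc j)) (+-≡ᵇ-+ k i' i))
  (cong (_∧ (j' ℕ.≡ᵇ j)) (trans (cong ((k ℕ.+ i') ℕ.≡ᵇ_) (sym (ℕₚ.+-suc k i))) (+-≡ᵇ-+ k i' (suc i))))

InTop : ℕ → List ℕ → Cell → Set
InTop k mu (i , j) = 1 ≤ i × i ≤ k × mu ! i < j

InBottom : ℕ → List ℕ → Cell → Set
InBottom k la (i , j) = 1 ≤ i × j ≤ drop k la ! i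

row-below-top : ∀ {k i i₂} → i ≤ k → 1 ≤ i₂ → i < k ℕ.+ i₂
row-below-top {k} {i} {i₂} i≤k 1≤i₂ = ℕₚ.≤-trans (s≤s i≤k) (subst (_≤ k ℕ.+ i₂) (ℕₚ.+-comm k 1) (ℕₚ.+-monoʳ-≤ k 1≤i₂))

-- The only way a bottom cell can sit directly below a top cell is in rows k and k + 1, and this is
-- excluded by μ_k ≥ λ_{k+1}.
adjacentOK-top-bottom : ∀ {k la mu} → la ! suc k ≤ mu ! k → ∀ q q' → InTop k mu (proj₁ q) → InBottom k la (proj₁ q') →
  adjacentOK q (relabel (shiftRow k) q') ≡ true
adjacentOK-top-bottom {k} {la} {mu} λ≤μ ((i , j) , e) ((i₂ , j₂) , e') (1≤i , i≤k , μ<j) (1≤i₂ , j₂≤λ) =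
  adjacentOK-apart i j e (k ℕ.+ i₂ , j₂) e' (eqCell-row≢ j₂ (suc j) (ℕₚ.>⇒≢ (row-below-top i≤k 1≤i₂))) below≢
  where
  below≢ : eqCell (k ℕ.+ i₂ , j₂) (suc i , j) ≡ false
  below≢ with (k ℕ.+ i₂) ℕ.≟ suc i
  ... | no row≢ = eqCell-row≢ j₂ j row≢
  ... | yes row≡ = eqCell-col≢ (k ℕ.+ i₂) (suc i) (ℕₚ.<⇒≢ (begin-strict
      j₂                  ≤⟨ j₂≤λ ⟩
      drop k la ! i₂      ≡⟨ cong (drop k la !_) i₂≡1 ⟩
      drop k la ! 1       ≡⟨ drop-! k la 0 ⟩
      la ! suc (k ℕ.+ 0)  ≡⟨ cong (λ n → la ! suc n) (ℕₚ.+-identityʳ k) ⟩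
      la ! suc k          ≤⟨ λ≤μ ⟩
      mu ! k              ≡⟨ cong (mu !_) i≡k ⟨
      mu ! i              <⟨ μ<j ⟩
      j                   ∎))
    where
    open ℕₚ.≤-Reasoning
    i₂≡1 : i₂ ≡ 1
    i₂≡1 = ℕₚ.≤-antisym (ℕₚ.+-cancelˡ-≤ k i₂ 1 (subst (k ℕ.+ i₂ ≤_) (ℕₚ.+-comm 1 k) (subst (_≤ suc k) (sym row≡) (s≤s i≤k)))) 1≤i₂
    i≡k : i ≡ k
    i≡k = ℕₚ.suc-injective (trans (sym row≡) (trans (cong (k ℕ.+_) i₂≡1) (ℕₚ.+-comm k 1)))

adjacentOK-bottom-top : ∀ {k la mu} q q' → InBottom k la (proj₁ q) → InTop k mu (proj₁ q') →
  adjacentOK (relabel (shiftRow k) q) q' ≡ true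
adjacentOK-bottom-top {k} ((i₂ , j₂) , e) ((i , j) , e') (1≤i₂ , _) (_ , i≤k , _) = adjacentOK-apart (k ℕ.+ i₂) j₂ e (i , j) e'
  (eqCell-row≢ j (suc j₂) (ℕₚ.<⇒≢ (row-below-top i≤k 1≤i₂)))
  (eqCell-row≢ j j₂ (ℕₚ.<⇒≢ (ℕₚ.m≤n⇒m≤1+n (row-below-top i≤k 1≤i₂))))

inBounds : List ℕ → List ℕ → Cell × Entry → Bool
inBounds r s ((i , j) , e) = (r ! i ℕ.≤ᵇ minE e) ∧ (maxE e ℕ.≤ᵇ s ! i)

drop-!-pos : ∀ k (xs : List ℕ) {i} → 1 ≤ i → drop k xs ! i ≡ xs ! (k ℕ.+ i)
drop-!-pos k xs {suc i} _ = trans (drop-! k xs i) (cong (xs !_) (sym (ℕₚ.+-suc k i)))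

∧-regroup : ∀ a₁ a₂ p₁ p₂ b₁ b₂ → ((a₁ ∧ a₂) ∧ ((p₁ ∧ p₂) ∧ (b₁ ∧ b₂))) ≡ ((a₁ ∧ (p₁ ∧ b₁)) ∧ (a₂ ∧ (p₂ ∧ b₂)))
∧-regroup a₁ a₂ p₁ p₂ b₁ b₂ = trans (cong ((a₁ ∧ a₂) ∧_) (∧-interchange p₁ p₂ b₁ b₂)) (∧-interchange a₁ a₂ (p₁ ∧ b₁) (p₂ ∧ b₂))

validTableau-split : ∀ {k la mu} r s → la ! suc k ≤ mu ! k → ∀ T₁ T₂ →
  All (InTop k mu ∘ proj₁) T₁ → All (InBottom k la ∘ proj₁) T₂ →
  validTableau r s (T₁ ++ map (relabel (shiftRow k)) T₂) ≡ (validTableau (take k r) (take k s) T₁ ∧ validTableau (drop k r) (drop k s) T₂)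
validTableau-split {k} r s λ≤μ T₁ T₂ top bottom = trans
  (cong₂ _∧_ entries≡ (cong₂ _∧_ adjacency≡ bounds≡))
  (∧-regroup (allB validEntry′ T₁) (allB validEntry′ T₂) (adjacency T₁) (adjacency T₂)
             (allB (inBounds (take k r) (take k s)) T₁) (allB (inBounds (drop k r) (drop k s)) T₂))
  where
  sh = relabel (shiftRow k)
  T₂' = map sh T₂
  validEntry′ : Cell × Entry → Bool
  validEntry′ = validEntry ∘ proj₂
  adjacency : Filling → Bool
  adjacency T = allB (λ q → allB (adjacentOK q) T) T
  entries≡ : allB validEntry′ (T₁ ++ T₂') ≡ (allB validEntry′ T₁ ∧ allB validEntry′ T₂)
  entries≡ = trans (allB-++ validEntry′ T₁ T₂') (cong (allB validEntry′ T₁ ∧_) (allB-map validEntry′ sh T₂))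
  F : Cell × Entry → Bool
  F q = allB (adjacentOK q) T₁ ∧ allB (adjacentOK q) T₂'
  top-part : allB F T₁ ≡ adjacency T₁
  top-part = allB-cong-local (All.map (λ {q} q-top →
    trans (cong (allB (adjacentOK q) T₁ ∧_) (trans (allB-map (adjacentOK q) sh T₂)
            (allB-true (All.map (λ {q'} q'-bottom → adjacentOK-top-bottom λ≤μ q q' q-top q'-bottom) bottom))))
          (Boolₚ.∧-identityʳ _)) top)
  bottom-part : allB F T₂' ≡ adjacency T₂
  bottom-part = trans (allB-map F sh T₂) (allB-cong-local (All.map (λ {q} q-bottom →
    trans (cong (_∧ allB (adjacentOK (sh q)) T₂') (allB-true (All.map (λ {q'} q'-top → adjacentOK-bottom-top q q' q-bottom q'-top) top)))
          (trans (allB-map (adjacentOK (sh q)) sh T₂) (allB-cong-local (All.universal (adjacentOK-shift k q) T₂)))) bottom))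
  adjacency≡ : adjacency (T₁ ++ T₂') ≡ (adjacency T₁ ∧ adjacency T₂)
  adjacency≡ = trans (allB-cong-local (All.universal (λ q → allB-++ (adjacentOK q) T₁ T₂') (T₁ ++ T₂')))
                     (trans (allB-++ F T₁ T₂') (cong₂ _∧_ top-part bottom-part))
  bounds≡ : allB (inBounds r s) (T₁ ++ T₂') ≡ (allB (inBounds (take k r) (take k s)) T₁ ∧ allB (inBounds (drop k r) (drop k s)) T₂)
  bounds≡ = trans (allB-++ (inBounds r s) T₁ T₂') (cong₂ _∧_
    (allB-cong-local (All.map (λ { {(i , j) , e} (_ , i≤k , _) →
       cong₂ (λ u v → (u ℕ.≤ᵇ minE e) ∧ (maxE e ℕ.≤ᵇ v)) (sym (take-! k r i≤k)) (sym (take-! k s i≤k)) }) top))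
    (trans (allB-map (inBounds r s) sh T₂) (allB-cong-local (All.map (λ { {(i , j) , e} (1≤i , _) →
       cong₂ (λ u v → (u ℕ.≤ᵇ minE e) ∧ (maxE e ℕ.≤ᵇ v)) (sym (drop-!-pos k r 1≤i)) (sym (drop-!-pos k s 1≤i)) }) bottom))))

monoS-addMon : ∀ p q → monoS (addMon p q) ≈ monoS p ⊛ monoS q
monoS-addMon p q = coeffwise λ m → sym (trans (⊛-coeff (monoS p) (monoS q) m) (∑ᴹ-𝟙𝟙 m p q))

monoS-monT : ∀ T → monoS (monT T) ≈ prodS (map (monoS ∘ monCell) T)
monoS-monT [] = ≈-refl
monoS-monT (q ∷ T) = ≈-trans (monoS-addMon (monCell q) (monT T)) (⊛-congˡ (monoS (monCell q)) (monoS-monT T))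

sumℕ-++ : ∀ xs ys → sumℕ (xs ++ ys) ≡ sumℕ xs ℕ.+ sumℕ ys
sumℕ-++ [] ys = refl
sumℕ-++ (x ∷ xs) ys = trans (cong (x ℕ.+_) (sumℕ-++ xs ys)) (sym (ℕₚ.+-assoc x _ _))

signT-++ : ∀ T₁ T₂ → signT (T₁ ++ T₂) ≡ signT T₁ * signT T₂
signT-++ T₁ T₂ = trans (cong ((- 1ℤ) ℤ.^_) (trans (cong sumℕ (Listₚ.map-++ (nMarked ∘ proj₂) T₁ T₂)) (sumℕ-++ (map (nMarked ∘ proj₂) T₁) _)))
  (ℤₚ.^-distribˡ-+-* (- 1ℤ) (sumℕ (map (nMarked ∘ proj₂) T₁)) (sumℕ (map (nMarked ∘ proj₂) T₂)))

signT-relabel : ∀ g T → signT (map (relabel g) T) ≡ signT T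
signT-relabel g T = cong (λ xs → (- 1ℤ) ℤ.^ sumℕ xs) (sym (Listₚ.map-∘ T))

signedMonomial : Filling → Series
signedMonomial T = signT T · monoS (monT T)

signedMonomial-++ : ∀ T₁ T₂ → signedMonomial (T₁ ++ T₂) ≈ signedMonomial T₁ ⊛ signedMonomial T₂
signedMonomial-++ T₁ T₂ = begin
  signT (T₁ ++ T₂) · monoS (monT (T₁ ++ T₂))
    ≈⟨ ≈-trans (≡⇒≈ (cong (_· monoS (monT (T₁ ++ T₂))) (signT-++ T₁ T₂))) (·-cong (σ₁ * σ₂) (monoS-monT (T₁ ++ T₂))) ⟩
  (σ₁ * σ₂) · prodS (map cell (T₁ ++ T₂))
    ≈⟨ ·-cong (σ₁ * σ₂) (≈-trans (≡⇒≈ (cong prodS (Listₚ.map-++ cell T₁ T₂))) (prodS-++ (map cell T₁) (map cell T₂))) ⟩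
  (σ₁ * σ₂) · (prodS (map cell T₁) ⊛ prodS (map cell T₂))
    ≈⟨ ·-cong (σ₁ * σ₂) (⊛-cong (monoS-monT T₁) (monoS-monT T₂)) ⟨
  (σ₁ * σ₂) · (monoS (monT T₁) ⊛ monoS (monT T₂))
    ≈⟨ ·-assoc σ₁ σ₂ _ ⟨
  σ₁ · (σ₂ · (monoS (monT T₁) ⊛ monoS (monT T₂)))
    ≈⟨ ·-cong σ₁ (⊛-· σ₂ (monoS (monT T₁)) (monoS (monT T₂))) ⟨
  σ₁ · (monoS (monT T₁) ⊛ signedMonomial T₂)
    ≈⟨ ·-⊛ σ₁ (monoS (monT T₁)) (signedMonomial T₂) ⟨
  signedMonomial T₁ ⊛ signedMonomial T₂ ∎
  where
  open ≈-Reasoning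
  σ₁ = signT T₁
  σ₂ = signT T₂
  cell = monoS ∘ monCell

expOf-shift : ∀ k {i} p → 1 ≤ i → expOf (k ℕ.+ i) p ≡ replicate k 0 ++ expOf i p
expOf-shift k {i} p 1≤i = trans (cong (λ n → replicate n 0 ++ [ p ]) (ℕₚ.+-∸-assoc k 1≤i)) (sym (replicate-++-++ 0 k (i ∸ 1) [ p ]))

φβ^-monCell : ∀ k q → 1 ≤ proj₁ (proj₁ q) → φβ^ k (monoS (monCell q)) ≈ monoS (monCell (relabel (shiftRow k) q))
φβ^-monCell k ((i , j) , e) 1≤i = ≈-trans (φβ^-monoS k (xExps e) (expOf j (nUnmarked e ∸ 1)) (expOf i (nMarked e)))
  (≡⇒≈ (cong (λ d → monoS (xExps e , expOf j (nUnmarked e ∸ 1) , d)) (sym (expOf-shift k (nMarked e) 1≤i))))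

φβ^-signedMonomial : ∀ k T → All (λ q → 1 ≤ proj₁ (proj₁ q)) T → φβ^ k (signedMonomial T) ≈ signedMonomial (map (relabel (shiftRow k)) T)
φβ^-signedMonomial k T rows≥1 = begin
  φβ^ k (signT T · monoS (monT T))
    ≈⟨ ·-endo endo (signT T) (monoS (monT T)) ⟩
  signT T · φβ^ k (monoS (monT T))
    ≈⟨ ·-cong (signT T) (≈-trans (cong-endo endo (monoS-monT T)) (prodS-endo endo (monoS ∘ monCell) T)) ⟩
  signT T · prodS (map (φβ^ k ∘ monoS ∘ monCell) T)
    ≈⟨ ·-cong (signT T) (prodS-cong-local (All.map (λ {q} → φβ^-monCell k q) rows≥1)) ⟩
  signT T · prodS (map (monoS ∘ monCell ∘ relabel (shiftRow k)) T)
    ≈⟨ ·-cong (signT T) (≈-trans (≡⇒≈ (cong prodS (Listₚ.map-∘ T))) (≈-sym (monoS-monT (map (relabel (shiftRow k)) T)))) ⟩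
  signT T · monoS (monT (map (relabel (shiftRow k)) T))
    ≡⟨ cong (_· monoS (monT (map (relabel (shiftRow k)) T))) (signT-relabel (shiftRow k) T) ⟨
  signedMonomial (map (relabel (shiftRow k)) T) ∎
  where
  open ≈-Reasoning
  endo = φβ^-isRingEndo k

if-zeroS-⊛ : ∀ k b₁ b₂ {X Y Z} → X ⊛ φβ^ k Y ≈ Z →
  (if b₁ then X else zeroS) ⊛ φβ^ k (if b₂ then Y else zeroS) ≈ (if b₁ ∧ b₂ then Z else zeroS)
if-zeroS-⊛ k true true XY≈Z = XY≈Z
if-zeroS-⊛ k true false {X} _ = ≈-trans (⊛-congˡ X (zero-endo (φβ^-isRingEndo k))) (⊛-zeroʳ X)
if-zeroS-⊛ k false b₂ {Y = Y} _ = ⊛-zeroˡ (φβ^ k (if b₂ then Y else zeroS))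

weight-split : ∀ {k la mu} r s → la ! suc k ≤ mu ! k → ∀ T₁ T₂ → All (InTop k mu ∘ proj₁) T₁ → All (InBottom k la ∘ proj₁) T₂ →
  weight (take k r) (take k s) T₁ ⊛ φβ^ k (weight (drop k r) (drop k s) T₂) ≈ weight r s (T₁ ++ map (relabel (shiftRow k)) T₂)
weight-split {k} r s λ≤μ T₁ T₂ top bottom = ≈-trans
  (if-zeroS-⊛ k (validTableau (take k r) (take k s) T₁) (validTableau (drop k r) (drop k s) T₂)
    (≈-trans (⊛-congˡ (signedMonomial T₁) (φβ^-signedMonomial k T₂ (All.map proj₁ bottom)))
             (≈-sym (signedMonomial-++ T₁ (map (relabel (shiftRow k)) T₂)))))
  (≡⇒≈ (cong (λ b → if b then signedMonomial (T₁ ++ map (relabel (shiftRow k)) T₂) else zeroS)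
             (sym (validTableau-split r s λ≤μ T₁ T₂ top bottom))))

-- Splitting the combinatorial formula

All-fillings : ∀ {P : Cell → Set} {cs} (T : Filling) → map proj₁ T ≡ cs → All P cs → All (P ∘ proj₁) T
All-fillings {P} T T↦cs all-cs = Allₚ.map⁻ (subst (All P) (sym T↦cs) all-cs)

cells-InTop : ∀ {k} la mu → k ≤ length la → All (InTop k mu) (cells (take k la) (take k mu))
cells-InTop {k} la mu k≤len = All-cells (take k la) (take k mu) λ {i} 1≤i i≤len μ<j _ →
  let i≤k = ℕₚ.≤-trans i≤len (ℕₚ.≤-reflexive (length-take-≤ k la k≤len)) in
  1≤i , i≤k , subst (_< _) (take-! k mu i≤k) μ<j

cells-InBottom : ∀ {k} la mu → All (InBottom k la) (cells (drop k la) (drop k mu))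
cells-InBottom {k} la mu = All-cells (drop k la) (drop k mu) λ 1≤i _ _ j≤λ → 1≤i , j≤λ

∑-weight-pairs : ∀ N D {k} la mu r s → k ≤ length la → la ! suc k ≤ mu ! k → ∀ m →
  ∑[ T₁ ← fillings N D (cells (take k la) (take k mu)) ] ∑[ T₂ ← fillings N D (cells (drop k la) (drop k mu)) ]
    (weight (take k r) (take k s) T₁ ⊛ φβ^ k (weight (drop k r) (drop k s) T₂)) m
  ≡ G≤ N D la mu r s m
∑-weight-pairs N D {k} la mu r s k≤len λ≤μ m = begin
  ∑[ T₁ ← fillings N D C₁ ] ∑[ T₂ ← fillings N D C₂ ] (weight (take k r) (take k s) T₁ ⊛ φβ^ k (weight (drop k r) (drop k s) T₂)) m
    ≡⟨ fillings-cong N D C₁ (λ T₁ T₁↦C₁ → fillings-cong N D C₂ λ T₂ T₂↦C₂ →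
         coeff (weight-split {k} {la} {mu} r s λ≤μ T₁ T₂ (All-fillings T₁ T₁↦C₁ (cells-InTop la mu k≤len))
                                                       (All-fillings T₂ T₂↦C₂ (cells-InBottom {k} la mu))) m) ⟩
  ∑[ T₁ ← fillings N D C₁ ] ∑[ T₂ ← fillings N D C₂ ] weight r s (T₁ ++ map (relabel (shiftRow k)) T₂) m
    ≡⟨ ∑-cong (λ T₁ → fillings-map N D (shiftRow k) C₂ (λ T₂ → weight r s (T₁ ++ T₂) m)) (fillings N D C₁) ⟨
  ∑[ T₁ ← fillings N D C₁ ] ∑[ T₂ ← fillings N D (map (shiftRow k) C₂) ] weight r s (T₁ ++ T₂) m
    ≡⟨ fillings-++ N D C₁ (map (shiftRow k) C₂) (λ T → weight r s T m) ⟨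
  ∑[ T ← fillings N D (C₁ ++ map (shiftRow k) C₂) ] weight r s T m
    ≡⟨ cong (λ cs → ∑[ T ← fillings N D cs ] weight r s T m) (cells-split k la mu k≤len) ⟨
  ∑[ T ← fillings N D (cells la mu) ] weight r s T m
    ≡⟨ sumS-coeff (weight r s) (fillings N D (cells la mu)) m ⟨
  G≤ N D la mu r s m ∎
  where
  open ≡-Reasoning
  C₁ = cells (take k la) (take k mu)
  C₂ = cells (drop k la) (drop k mu)

G≤-split : ∀ N D {k} la mu r s → k ≤ length la → la ! suc k ≤ mu ! k →
  G≤ N D la mu r s ≈ G≤ N D (take k la) (take k mu) (take k r) (take k s) ⊛ φβ^ k (G≤ N D (drop k la) (drop k mu) (drop k r) (drop k s))
G≤-split N D {k} la mu r s k≤len λ≤μ = ≈-sym (begin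
  sumS (map w₁ F₁) ⊛ φβ^ k (sumS (map w₂ F₂))
    ≈⟨ ⊛-congˡ (sumS (map w₁ F₁)) (sumS-endo (φβ^-isRingEndo k) w₂ F₂) ⟩
  sumS (map w₁ F₁) ⊛ sumS (map (φβ^ k ∘ w₂) F₂)
    ≈⟨ ≈-trans (sumS-⊛ w₁ F₁ (sumS (map (φβ^ k ∘ w₂) F₂))) (sumS-cong (λ T₁ → ⊛-sumS (φβ^ k ∘ w₂) F₂ (w₁ T₁)) F₁) ⟩
  sumS (map (λ T₁ → sumS (map (λ T₂ → w₁ T₁ ⊛ φβ^ k (w₂ T₂)) F₂)) F₁)
    ≈⟨ coeffwise (λ m → trans (trans (sumS-coeff _ F₁ m) (∑-cong (λ T₁ → sumS-coeff _ F₂ m) F₁))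
                              (∑-weight-pairs N D la mu r s k≤len λ≤μ m)) ⟩
  G≤ N D la mu r s ∎)
  where
  open ≈-Reasoning
  F₁ = fillings N D (cells (take k la) (take k mu))
  F₂ = fillings N D (cells (drop k la) (drop k mu))
  w₁ = weight (take k r) (take k s)
  w₂ = weight (drop k r) (drop k s)

AgreeBelow : Exps → Series → Series → Set
AgreeBelow a F G = ∀ x c d → length x ≤ length a → sumℕ x ≤ sumℕ a → F (x , c , d) ≡ G (x , c , d)

∑≤-cong-below : ∀ a {f g : Exps → ℤ} → (∀ x → length x ≤ length a → sumℕ x ≤ sumℕ a → f x ≡ g x) → ∑≤ a f ≡ ∑≤ a g
∑≤-cong-below [] f≗g = cong (_+ 0ℤ) (f≗g [] z≤n z≤n)
∑≤-cong-below (e ∷ es) {f} {g} f≗g = trans (∑≤-∷ e es f) (trans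
  (∑-cong-upTo (suc e) λ {j} j≤e → ∑≤-cong-below es λ t len≤ sum≤ → f≗g (j ∷ t) (s≤s len≤) (ℕₚ.+-mono-≤ (ℕₚ.≤-pred j≤e) sum≤))
  (sym (∑≤-∷ e es g)))

length-subE : ∀ a x → length (subE a x) ≤ length a
length-subE [] x = z≤n
length-subE (y ∷ a) [] = ℕₚ.≤-refl
length-subE (y ∷ a) (z ∷ x) = s≤s (length-subE a x)

sumℕ-subE : ∀ a x → sumℕ (subE a x) ≤ sumℕ a
sumℕ-subE [] x = z≤n
sumℕ-subE (y ∷ a) [] = ℕₚ.≤-refl
sumℕ-subE (y ∷ a) (z ∷ x) = ℕₚ.+-mono-≤ (ℕₚ.m∸n≤m y z) (sumℕ-subE a x)

⊛-agree : ∀ {a} F F' G G' → AgreeBelow a F F' → AgreeBelow a G G' → ∀ c d → (F ⊛ G) (a , c , d) ≡ (F' ⊛ G') (a , c , d)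
⊛-agree {a} F F' G G' F≡F' G≡G' c d = trans (⊛-coeff F G (a , c , d)) (trans
  (∑≤-cong-below a λ x len≤ sum≤ → ∑≤-cong c λ c' → ∑≤-cong d λ d' →
    cong₂ _*_ (F≡F' x c' d' len≤ sum≤) (G≡G' (subE a x) (subE c c') (subE d d') (length-subE a x) (sumℕ-subE a x)))
  (sym (⊛-coeff F' G' (a , c , d))))

φβ^-agree : ∀ k {a} F G → AgreeBelow a F G → AgreeBelow a (φβ^ k F) (φβ^ k G)
φβ^-agree zero F G F≡G = F≡G
φβ^-agree (suc k) {a} F G F≡G x c [] len≤ sum≤ = φβ^-agree k {a} F G F≡G x c [] len≤ sum≤
φβ^-agree (suc k) {a} F G F≡G x c (zero ∷ d) len≤ sum≤ = φβ^-agree k {a} F G F≡G x c d len≤ sum≤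
φβ^-agree (suc k) F G F≡G x c (suc _ ∷ d) len≤ sum≤ = refl

G≤-agree : ∀ a la mu r s → AgreeBelow a (G≤ (length a) (sumℕ a) la mu r s) (G la mu r s)
G≤-agree a la mu r s x c d len≤ sum≤ = G≤-coeff la mu r s x c d len≤ sum≤

G-split : ∀ {k} la mu r s → k ≤ length la → la ! suc k ≤ mu ! k →
  G la mu r s ≈ G (take k la) (take k mu) (take k r) (take k s) ⊛ φβ^ k (G (drop k la) (drop k mu) (drop k r) (drop k s))
G-split {k} la mu r s k≤len λ≤μ = coeffwise split
  where
  open ≡-Reasoning
  la₁ = take k la
  mu₁ = take k mu
  r₁ = take k r
  s₁ = take k s
  la₂ = drop k la
  mu₂ = drop k mu
  r₂ = drop k r
  s₂ = drop k s
  split : ∀ m → G la mu r s m ≡ (G (take k la) (take k mu) (take k r) (take k s) ⊛ φβ^ k (G (drop k la) (drop k mu) (drop k r) (drop k s))) m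
  split (a , c , d) = begin
    G la mu r s (a , c , d)
      ≡⟨ G≤-coeff la mu r s a c d ℕₚ.≤-refl ℕₚ.≤-refl ⟨
    G≤ (length a) (sumℕ a) la mu r s (a , c , d)
      ≡⟨ coeff (G≤-split (length a) (sumℕ a) la mu r s k≤len λ≤μ) (a , c , d) ⟩
    (G≤ (length a) (sumℕ a) (take k la) (take k mu) (take k r) (take k s)
      ⊛ φβ^ k (G≤ (length a) (sumℕ a) (drop k la) (drop k mu) (drop k r) (drop k s))) (a , c , d)
      ≡⟨ ⊛-agree {a} (G≤ (length a) (sumℕ a) la₁ mu₁ r₁ s₁) (G la₁ mu₁ r₁ s₁)
                 (φβ^ k (G≤ (length a) (sumℕ a) la₂ mu₂ r₂ s₂)) (φβ^ k (G la₂ mu₂ r₂ s₂))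
                 (G≤-agree a la₁ mu₁ r₁ s₁)
                 (φβ^-agree k {a} (G≤ (length a) (sumℕ a) la₂ mu₂ r₂ s₂) (G la₂ mu₂ r₂ s₂) (G≤-agree a la₂ mu₂ r₂ s₂)) c d ⟩
    (G (take k la) (take k mu) (take k r) (take k s) ⊛ φβ^ k (G (drop k la) (drop k mu) (drop k r) (drop k s))) (a , c , d) ∎

lemma3p12 : (n k : ℕ) (la mu r s : List ℕ) →
    length la ≡ n → length mu ≡ n → length r ≡ n → length s ≡ n →
    IsPartition la → IsPartition mu → (∀ i → mu ! i ≤ la ! i) →
    1 ≤ k → k < n → la ! suc k ≤ mu ! k →
    (G la mu r s ≋ G (take k la) (take k mu) (take k r) (take k s)
                    ⊛ iter k φβ (G (drop k la) (drop k mu) (drop k r) (drop k s)))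
    × (Gt la mu r s ≋ Gt (take k la) (take k mu) (take k r) (take k s)
                    ⊛ iter k φβ (Gt (drop k la) (drop k mu) (drop k r) (drop k s)))
lemma3p12 n k la mu r s len-la _ _ _ la-part mu-part _ _ k<n λ≤μ =
  coeff (G-split la mu r s (subst (k ≤_) (sym len-la) k≤n) λ≤μ) ,
  coeff (Gt-split la mu r s len-la k≤n la-part mu-part λ≤μ)
  where
  k≤n = ℕₚ.<⇒≤ k<n
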